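{- Let $d\ge2$, $\alpha=\frac{d+\sqrt{d^2+4}}{2}$, and let $(A_{m,n})$ and $(\bar A_{k,n})$ be the $d$-Ostrowski array and the negative $d$-Ostrowski array. Say that in row $k$ of the negative array the red wall and the left wall coincide if there is $m\ge1$ with $|\bar A_{k,n}|=A_{m,n}$ for all $n\ge1$. Then: (i) whenever the red wall and the left wall coincide in row $k$, $\bar A_{k,1}>0$; (ii) a positive integer $N$ equals $\bar A_{k,1}$ for some row $k$ in which the red wall and the left wall coincide if and only if $\alpha N-\lfloor\alpha N\rfloor\in\left[\frac1\alpha,1-\frac1\alpha\right]$.
   Context: Define $(D_n)$ by $D_0=0$, $D_1=1$, $D_{n+1}=dD_n+D_{n-1}$. An Ostrowski word is a finite word $d_1\cdots d_i$ over $\{0,\dots,d\}$ with $0\le d_1<d$, $0\le d_j\le d$ for $j>1$, and $d_{j-1}=0$ whenever $d_j=d$; it represents $\sum_j d_jD_j$. Every non-negative integer has a unique Ostrowski word with nonzero last digit. An Ostrowski word is trimmed if its last digit is nonzero and it cannot be written as $0v$ with $v$ an Ostrowski word (equivalently, its first digit is nonzero, or its first two digits are $0$ and $d$). Let $w_1,w_2,\dots$ be the trimmed Ostrowski words listed in increasing order of the integers they represent, and $|w_m|$ the length of $w_m$. The $d$-Ostrowski array is $A_{m,n}=$ the integer represented by $0^{n-1}w_m$ ($m,n\ge1$); its rows satisfy $A_{m,n+1}=dA_{m,n}+A_{m,n-1}$ and are extended to all $n\in\mathbb Z$ by this recurrence. The negative $d$-Ostrowski array is $\bar A_{k,n}=A_{k,r_k-n}$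 for $k\ge1$, $n\ge1$, where $r_k=1-|w_k|$. -}

module Defs where

open import Data.Nat as ℕ using (ℕ; zero; suc)
open import Data.Integer as ℤ using (ℤ; +_; -[1+_]; ∣_∣)
open import Data.List using (List; []; _∷_; _++_; replicate; length)
open import Data.List.Membership.Propositional using (_∈_)
open import Data.List.Relation.Unary.Unique.Propositional using (Unique)
open import Data.Product using (Σ; _×_; _,_; proj₁; proj₂)
open import Data.Sum using (_⊎_)
open import Data.Unit using (⊤)
open import Data.Empty using (⊥)
open import Relation.Nullary using (¬_)
open import Relation.Binary.PropositionalEquality using (_≡_; _≢_)
open import Function.Bundles using (_⇔_)

module Ost (d : ℕ) where

  D : ℕ → ℕ
  D zero = 0
  D (suc zero) = 1
  D (suc (suc n)) = d ℕ.* D (suc n) ℕ.+ D n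

  -- A word d_1 ⋯ d_i is a list of digits, d_1 first.
  Word : Set
  Word = List ℕ

  OstTail : ℕ → Word → Set
  OstTail prev [] = ⊤
  OstTail prev (y ∷ ys) = (y ℕ.≤ d) × ((y ≡ d → prev ≡ 0) × OstTail y ys)

  OstWord : Word → Set
  OstWord [] = ⊤
  OstWord (x ∷ xs) = (x ℕ.< d) × OstTail x xs

  valFrom : ℕ → Word → ℕ
  valFrom k [] = 0
  valFrom k (x ∷ xs) = x ℕ.* D k ℕ.+ valFrom (suc k) xs

  val : Word → ℕ
  val = valFrom 1

  LastNonzero : Word → Set
  LastNonzero [] = ⊥
  LastNonzero (x ∷ []) = x ≢ 0
  LastNonzero (x ∷ y ∷ ys) = LastNonzero (y ∷ ys)

  Trimmed : Word → Set
  Trimmed w = OstWord w × (LastNonzero w × (¬ (Σ Word λ v → OstWord v × (w ≡ 0 ∷ v))))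

  -- IsW m w : w is w_m, the m-th trimmed word (m ≥ 1) in increasing order of value,
  -- i.e. w is trimmed and exactly m-1 trimmed words have smaller value.
  IsW : ℕ → Word → Set
  IsW m w = Trimmed w × Σ (List Word) λ L →
              Unique L × ((suc (length L) ≡ m) ×
              ((u : Word) → (u ∈ L) ⇔ (Trimmed u × (val u ℕ.< val w))))

  -- the row of the d-Ostrowski array attached to the word w, for n ∈ ℤ:
  -- for n ≥ 1 it is the value of 0^{n-1} w; for n ≤ 0 it is extended
  -- backwards by the recurrence A_{n-1} = A_{n+1} - d A_n.
  rowPos : Word → ℕ → ℤ          -- rowPos w k = A_{k+1}
  rowPos w k = + val (replicate k 0 ++ w)

  back : Word → ℕ → ℤ × ℤ        -- back w j = (A_{1-j} , A_{2-j})
  back w zero = rowPos w 0 , rowPos w 1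
  back w (suc j) = (proj₂ (back w j) ℤ.- (+ d) ℤ.* proj₁ (back w j)) , proj₁ (back w j)

  row : Word → ℤ → ℤ
  row w (+ suc k) = rowPos w k
  row w (+ zero) = proj₁ (back w 1)
  row w -[1+ k ] = proj₁ (back w (suc (suc k)))

  -- A_{m,n} : the array entry, given as the row of w_m
  -- negative array: Ā_{k,n} = A_{k, r_k - n}, r_k = 1 - |w_k|
  negRow : Word → ℕ → ℤ
  negRow w n = row w ((+ 1 ℤ.- + length w) ℤ.- + n)

  Coincide : ℕ → Set
  Coincide k = Σ Word λ wk → IsW k wk × Σ ℕ λ m → Σ Word λ wm → IsW m wm ×
                 ((n : ℕ) → 1 ℕ.≤ n → + ∣ negRow wk n ∣ ≡ row wm (+ n))

  -- Exact arithmetic in ℤ[α], α = (d + √S)/2, S = d² + 4.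
  -- A pair (a , b) represents a + b α.
  S : ℤ
  S = + (d ℕ.* d ℕ.+ 4)

  -- c + b √S ≥ 0
  NonNegS : ℤ → ℤ → Set
  NonNegS c b = ((+ 0 ℤ.≤ c) × (+ 0 ℤ.≤ b))
              ⊎ ((+ 0 ℤ.≤ c) × ((b ℤ.< + 0) × (b ℤ.* b ℤ.* S ℤ.≤ c ℤ.* c)))
              ⊎ ((c ℤ.< + 0) × ((+ 0 ℤ.≤ b) × (c ℤ.* c ℤ.≤ b ℤ.* b ℤ.* S)))

  -- c + b √S > 0
  PosS : ℤ → ℤ → Set
  PosS c b = ((+ 0 ℤ.< c) × (+ 0 ℤ.≤ b))
           ⊎ ((+ 0 ℤ.≤ c) × (+ 0 ℤ.< b))
           ⊎ ((+ 0 ℤ.< c) × ((b ℤ.< + 0) × (b ℤ.* b ℤ.* S ℤ.< c ℤ.* c)))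
           ⊎ ((c ℤ.< + 0) × ((+ 0 ℤ.< b) × (c ℤ.* c ℤ.< b ℤ.* b ℤ.* S)))

  Elt : Set
  Elt = ℤ × ℤ

  _-ᴱ_ : Elt → Elt → Elt
  (a , b) -ᴱ (a' , b') = (a ℤ.- a') , (b ℤ.- b')

  -- 2(a + bα) = (2a + b d) + b √S
  NonNegᴱ : Elt → Set
  NonNegᴱ (a , b) = NonNegS ((+ 2) ℤ.* a ℤ.+ b ℤ.* (+ d)) b

  Posᴱ : Elt → Set
  Posᴱ (a , b) = PosS ((+ 2) ℤ.* a ℤ.+ b ℤ.* (+ d)) b

  _≤ᴱ_ : Elt → Elt → Set
  x ≤ᴱ y = NonNegᴱ (y -ᴱ x)

  _<ᴱ_ : Elt → Elt → Set
  x <ᴱ y = Posᴱ (y -ᴱ x)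

  ofℤ : ℤ → Elt
  ofℤ q = q , + 0

  αN : ℕ → Elt
  αN N = + 0 , + N

  -- 1/α = α - d  (since α² = dα + 1)
  invα : Elt
  invα = ℤ.- (+ d) , + 1

  IsFloor : ℤ → Elt → Set
  IsFloor q x = (ofℤ q ≤ᴱ x) × (x <ᴱ ofℤ (q ℤ.+ + 1))

  FracCond : ℕ → Set
  FracCond N = Σ ℤ λ q → IsFloor q (αN N) ×
                 ((invα ≤ᴱ (αN N -ᴱ ofℤ q)) × ((αN N -ᴱ ofℤ q) ≤ᴱ (ofℤ (+ 1) -ᴱ invα)))

-- An element x = a + bα of ℤ[α] is compared with 0 through the integer sequence
-- a Dₙ + b Dₙ₊₁, the α-coefficient of x αⁿ: its sign is eventually the sign of x, and
-- Cassini's identity turns this into the √S-description of the order used in FracCond.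
--
-- For a word u, F u = α V u - H u (V u = A₁, H u = A₂ for the row of u) satisfies
-- F (x ∷ u) = α⁻¹ (x - F u), which keeps F in the window (-α⁻¹ , 1 - α⁻¹) of length 1 on
-- Ostrowski words; hence the Ostrowski word of N is unique and H is determined by V = N.
--
-- The first two entries of the negative row of wₖ form ρ = Ā₂ + Ā₁ α = α^{-|wₖ|-2} (A₁ + A₂ α),
-- and ρ ≥ α⁻¹ because the top digit is nonzero.  If |Ā| is the row of wₘ, the signs of the
-- first three entries force ρ = F wₘ, so Ā₁ = V wₘ = N > 0 and αN - H wₘ lies in
-- [α⁻¹ , 1 - α⁻¹).  Conversely, if φ = αN - ⌊αN⌋ lies in that window, the greedy α-expansion
-- of φ gives a trimmed wₖ with ρ = φ, the Ostrowski word of N has F = φ, and the two rows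
-- then agree up to alternating signs.

module Submission where

open import Defs
open import Data.Nat as ℕ using (ℕ; zero; suc; z≤n; s≤s)
open import Data.Nat.DivMod using (m≡m%n+[m/n]*n; m%n<n; m<n⇒m/n≡0; m<n*o⇒m/o<n)
import Data.Nat.Properties as ℕₚ
open import Data.Integer as ℤ using (ℤ; +_)
open import Data.Integer.Base hiding (suc; _/_; _%_)
open import Data.Integer.Properties
open import Data.Integer.Tactic.RingSolver using (solve-∀)
open import Data.Nat.Solver using () renaming (module +-*-Solver to ℕ-Solver)
open import Data.List using (List; []; _∷_; _++_; replicate; length; concatMap; map; upTo; filter; deduplicate)
open import Data.List.Properties using (≡-dec; length-removeAt′; length-++; ∷-injectiveˡ; ∷-injectiveʳ)
open import Data.List.Relation.Unary.All as All using (All; []; _∷_)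
open import Data.List.Relation.Unary.Any using (here; there; _─_)
open import Data.List.Relation.Unary.AllPairs using ([]; _∷_)
open import Data.List.Relation.Unary.Unique.Propositional using (Unique)
import Data.List.Relation.Unary.Unique.Propositional.Properties as Unique
import Data.List.Relation.Unary.Unique.DecPropositional.Properties as UniqueDec
open import Data.List.Membership.Propositional using (_∈_; lose)
open import Data.List.Membership.Propositional.Properties
  using (∈-concatMap⁺; ∈-map⁺; ∈-upTo⁺; ∈-filter⁺; ∈-filter⁻; ∈-deduplicate⁺)
open import Data.Unit using (⊤; tt)
open import Function.Bundles using (_⇔_; mk⇔; Equivalence)
open import Data.Product using (Σ; Σ-syntax; _×_; _,_; proj₁; proj₂)
open import Data.Sum using (_⊎_; inj₁; inj₂)
open import Data.Empty using (⊥; ⊥-elim)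
open import Relation.Nullary using (¬_; Dec; yes; no)
open import Relation.Nullary.Decidable using (_×-dec_; _→-dec_; ¬?)
open import Relation.Binary.Definitions using (tri<; tri≈; tri>)
open import Relation.Binary.PropositionalEquality
open import Function using (_$_; _∘′_)

0<i+j : ∀ {i j} → 0ℤ < i → 0ℤ ≤ j → 0ℤ < i + j
0<i+j {i} {j} p q = subst (_< i + j) (+-identityʳ 0ℤ) (+-mono-<-≤ p q)

0≤i+j : ∀ {i j} → 0ℤ ≤ i → 0ℤ ≤ j → 0ℤ ≤ i + j
0≤i+j {i} {j} p q = subst (_≤ i + j) (+-identityʳ 0ℤ) (+-mono-≤ p q)

0<i*j : ∀ {i j} → 0ℤ < i → 0ℤ < j → 0ℤ < i * j
0<i*j {i} {j} p q = subst (_< i * j) (*-zeroʳ i) (*-monoˡ-<-pos i {{positive p}} q)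

0≤i*j : ∀ {i j} → 0ℤ ≤ i → 0ℤ ≤ j → 0ℤ ≤ i * j
0≤i*j {i} {j} p q = subst (_≤ i * j) (*-zeroʳ i) (*-monoˡ-≤-nonNeg i {{nonNegative p}} q)

0≤i*j⇒0≤i : ∀ {i j} → 0ℤ < j → 0ℤ ≤ i * j → 0ℤ ≤ i
0≤i*j⇒0≤i {i} {j} 0<j 0≤ij with <-cmp i 0ℤ
... | tri< i<0 _ _ = ⊥-elim (<⇒≱ (*-monoʳ-<-pos j {{positive 0<j}} i<0) (subst (_≤ i * j) (sym (*-zeroˡ j)) 0≤ij))
... | tri≈ _ i≡0 _ = ≤-reflexive (sym i≡0)
... | tri> _ _ 0<i = <⇒≤ 0<i

i*j≤0 : ∀ {i j} → i ≤ 0ℤ → 0ℤ ≤ j → i * j ≤ 0ℤ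
i*j≤0 {i} {j} p q = subst (i * j ≤_) (*-zeroˡ j) (*-monoʳ-≤-nonNeg j {{nonNegative q}} p)

0≤i*i : ∀ i → 0ℤ ≤ i * i
0≤i*i (+ n) = 0≤i*j {+ n} {+ n} (+≤+ z≤n) (+≤+ z≤n)
0≤i*i -[1+ n ] = +≤+ z≤n

i<j⇒0<j-i : ∀ {i j} → i < j → 0ℤ < j - i
i<j⇒0<j-i {i} {j} p = subst (_< j - i) (+-inverseʳ i) (+-monoˡ-< (- i) p)

0<j-i⇒i<j : ∀ {i j} → 0ℤ < j - i → i < j
0<j-i⇒i<j {i} {j} p = subst₂ _<_ (+-identityˡ i) (cancel j i) (+-monoˡ-< i p)
  where
  cancel : ∀ j i → j - i + i ≡ j
  cancel = solve-∀

0<i*j⇒0<i : ∀ {i j} → 0ℤ ≤ j → 0ℤ < i * j → 0ℤ < i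
0<i*j⇒0<i {i} {j} 0≤j 0<ij with <-cmp i 0ℤ
... | tri> _ _ 0<i = 0<i
... | tri≈ _ refl _ = ⊥-elim (<-irrefl (sym (*-zeroˡ j)) 0<ij)
... | tri< i<0 _ _ = ⊥-elim (<⇒≱ 0<ij (i*j≤0 (<⇒≤ i<0) 0≤j))

0≤i<j⇒i*i<j*j : ∀ {i j} → 0ℤ ≤ i → i < j → i * i < j * j
0≤i<j⇒i*i<j*j {i} {j} 0≤i i<j =
  ≤-<-trans (*-monoˡ-≤-nonNeg i {{nonNegative 0≤i}} (<⇒≤ i<j))
            (*-monoʳ-<-pos j {{positive (≤-<-trans 0≤i i<j)}} i<j)

-i*-i≡i*i : ∀ i → - i * - i ≡ i * i
-i*-i≡i*i = solve-∀

0<i*i : ∀ {i} → i ≢ 0ℤ → 0ℤ < i * i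
0<i*i { +[1+ n ]} _ = +<+ (s≤s z≤n)
0<i*i { +0} i≢0 = ⊥-elim (i≢0 refl)
0<i*i { -[1+ n ]} _ = +<+ (s≤s z≤n)


a+b≡c+e⇒a-c≡e-b : ∀ {a b c e} → a + b ≡ c + e → a - c ≡ e - b
a+b≡c+e⇒a-c≡e-b {a} {b} {c} {e} eq = begin
  a - c             ≡⟨ expand a b c ⟩
  (a + b) - (c + b) ≡⟨ cong (λ z → z - (c + b)) eq ⟩
  (c + e) - (c + b) ≡⟨ collapse c e b ⟩
  e - b             ∎
  where
  open ≡-Reasoning
  expand : ∀ a b c → a - c ≡ (a + b) - (c + b)
  expand = solve-∀
  collapse : ∀ c e b → (c + e) - (c + b) ≡ e - b
  collapse = solve-∀

+∣i∣≡j⇒i≡±j : ∀ {i j} → + ∣ i ∣ ≡ j → i ≡ j ⊎ i ≡ - j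
+∣i∣≡j⇒i≡±j {i} refl with +∣i∣≡i⊎+∣i∣≡-i i
... | inj₁ e = inj₁ (sym e)
... | inj₂ e = inj₂ (trans (sym (neg-involutive i)) (cong -_ (sym e)))

i+i≢0 : ∀ {i} → 0ℤ < i → i + i ≢ 0ℤ
i+i≢0 0<i eq = <-irrefl (sym eq) (0<i+j 0<i (<⇒≤ 0<i))

+-cancelˡ : ∀ i {j k} → i + j ≡ i + k → j ≡ k
+-cancelˡ i {j} {k} eq = trans (sym (-i+[i+j]≡j i j)) (trans (cong (λ z → - i + z) eq) (-i+[i+j]≡j i k))
  where
  -i+[i+j]≡j : ∀ i j → - i + (i + j) ≡ j
  -i+[i+j]≡j = solve-∀

module _ {A : Set} where

  ∈-─ : ∀ {x z : A} {ys} (x∈ys : x ∈ ys) → z ∈ ys → z ≢ x → z ∈ (ys ─ x∈ys)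
  ∈-─ (here refl) (here refl) z≢x = ⊥-elim (z≢x refl)
  ∈-─ (here refl) (there z∈ys) _ = z∈ys
  ∈-─ (there x∈ys) (here refl) _ = here refl
  ∈-─ (there x∈ys) (there z∈ys) z≢x = there (∈-─ x∈ys z∈ys z≢x)

  Unique-⊆⇒length-≤ : ∀ {xs ys : List A} → Unique xs → (∀ {z} → z ∈ xs → z ∈ ys) → length xs ℕ.≤ length ys
  Unique-⊆⇒length-≤ {[]} _ _ = z≤n
  Unique-⊆⇒length-≤ {x ∷ xs} {ys} (x∉xs ∷ unique) xs⊆ys = begin
    suc (length xs)           ≤⟨ s≤s (Unique-⊆⇒length-≤ unique xs⊆ys─x) ⟩
    suc (length (ys ─ x∈ys))  ≡⟨ sym (length-removeAt′ ys _) ⟩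
    length ys                 ∎
    where
    open ℕₚ.≤-Reasoning
    x∈ys : x ∈ ys
    x∈ys = xs⊆ys (here refl)
    xs⊆ys─x : ∀ {z} → z ∈ xs → z ∈ (ys ─ x∈ys)
    xs⊆ys─x z∈xs = ∈-─ x∈ys (xs⊆ys (there z∈xs)) (λ z≡x → All.lookup x∉xs z∈xs (sym z≡x))

module Ostrowski (d : ℕ) (2≤d : 2 ℕ.≤ d) where
  open Ost d

  -- The order of ℤ[α] through linear recurrences

  δ : ℤ
  δ = + d

  0<d : 0 ℕ.< d
  0<d = ℕₚ.<-≤-trans (s≤s z≤n) 2≤d

  0<δ : 0ℤ < δ
  0<δ = +<+ 0<d

  0<D : ∀ n → 0 ℕ.< D (suc n)
  0<D zero = s≤s z≤n
  0<D (suc n) = ℕₚ.<-≤-trans (ℕₚ.*-mono-< 0<d (0<D n)) (ℕₚ.m≤m+n (d ℕ.* D (suc n)) (D n))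

  n≤D : ∀ n → n ℕ.≤ D n
  n≤D zero = z≤n
  n≤D (suc zero) = s≤s z≤n
  n≤D (suc (suc n)) = begin
    suc (suc n)              ≤⟨ s≤s (n≤D (suc n)) ⟩
    suc (D (suc n))          ≤⟨ ℕₚ.+-monoˡ-≤ (D (suc n)) (0<D n) ⟩
    D (suc n) ℕ.+ D (suc n)  ≡⟨ cong (D (suc n) ℕ.+_) (sym (ℕₚ.+-identityʳ (D (suc n)))) ⟩
    2 ℕ.* D (suc n)          ≤⟨ ℕₚ.*-monoˡ-≤ (D (suc n)) 2≤d ⟩
    d ℕ.* D (suc n)          ≤⟨ ℕₚ.m≤m+n (d ℕ.* D (suc n)) (D n) ⟩
    d ℕ.* D (suc n) ℕ.+ D n  ∎
    where open ℕₚ.≤-Reasoning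

  Dℤ : ℕ → ℤ
  Dℤ n = + D n

  Linear : (ℕ → ℤ) → Set
  Linear t = ∀ n → t (suc (suc n)) ≡ δ * t (suc n) + t n

  D-linear : Linear Dℤ
  D-linear n = trans (pos-+ (d ℕ.* D (suc n)) (D n)) (cong (_+ Dℤ n) (pos-* d (D (suc n))))

  Linear-comb : ∀ a b {t s} → Linear t → Linear s → Linear (λ n → a * t n + b * s n)
  Linear-comb a b {t} {s} lt ls n = begin
    a * t (suc (suc n)) + b * s (suc (suc n))
      ≡⟨ cong₂ (λ u v → a * u + b * v) (lt n) (ls n) ⟩
    a * (δ * t (suc n) + t n) + b * (δ * s (suc n) + s n)
      ≡⟨ distribute a b δ (t (suc n)) (t n) (s (suc n)) (s n) ⟩
    δ * (a * t (suc n) + b * s (suc n)) + (a * t n + b * s n) ∎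
    where
    open ≡-Reasoning
    distribute : ∀ a b δ t₁ t₀ s₁ s₀ →
      a * (δ * t₁ + t₀) + b * (δ * s₁ + s₀) ≡ δ * (a * t₁ + b * s₁) + (a * t₀ + b * s₀)
    distribute = solve-∀

  Linear-neg : ∀ {t} → Linear t → Linear (λ n → - t n)
  Linear-neg {t} lt n = trans (cong -_ (lt n)) (negate δ (t (suc n)) (t n))
    where
    negate : ∀ δ u v → - (δ * u + v) ≡ δ * - u + - v
    negate = solve-∀

  -- seq x n is the α-coefficient of x αⁿ.  Since the conjugate of α has modulus
  -- below 1, its sign is eventually the sign of x.
  seq : Elt → ℕ → ℤ
  seq (a , b) n = a * Dℤ n + b * Dℤ (suc n)

  seq-linear : ∀ x → Linear (seq x)
  seq-linear (a , b) = Linear-comb a b D-linear (λ n → D-linear (suc n))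

  infixl 6 _+ᴱ_
  infix 25 α·_ α⁻¹·_ α^_·_
  infix 4 _<ₛ_ _≤ₛ_

  _+ᴱ_ : Elt → Elt → Elt
  (a , b) +ᴱ (a′ , b′) = a + a′ , b + b′

  negᴱ : Elt → Elt
  negᴱ (a , b) = - a , - b

  α·_ : Elt → Elt
  α· (a , b) = b , a + δ * b

  α⁻¹·_ : Elt → Elt
  α⁻¹· (a , b) = b - δ * a , a

  0ᴱ : Elt
  0ᴱ = ofℤ 0ℤ

  +ᴱ-comm : ∀ x y → x +ᴱ y ≡ y +ᴱ x
  +ᴱ-comm (a , b) (a′ , b′) = cong₂ _,_ (+-comm a a′) (+-comm b b′)

  α·α⁻¹· : ∀ x → α· (α⁻¹· x) ≡ x
  α·α⁻¹· (a , b) = cong (a ,_) (cancel a b δ)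
    where
    cancel : ∀ a b δ → b - δ * a + δ * a ≡ b
    cancel = solve-∀

  seq-+ : ∀ x y n → seq (x +ᴱ y) n ≡ seq x n + seq y n
  seq-+ (a , b) (a′ , b′) n = regroup a b a′ b′ (Dℤ n) (Dℤ (suc n))
    where
    regroup : ∀ a b a′ b′ p q → (a + a′) * p + (b + b′) * q ≡ (a * p + b * q) + (a′ * p + b′ * q)
    regroup = solve-∀

  seq-neg : ∀ x n → seq (negᴱ x) n ≡ - seq x n
  seq-neg (a , b) n = negate a b (Dℤ n) (Dℤ (suc n))
    where
    negate : ∀ a b p q → - a * p + - b * q ≡ - (a * p + b * q)
    negate = solve-∀

  seq-α : ∀ x n → seq (α· x) n ≡ seq x (suc n)
  seq-α (a , b) n = trans (regroup a b δ (Dℤ (suc n)) (Dℤ n))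
                          (cong (λ u → a * Dℤ (suc n) + b * u) (sym (D-linear n)))
    where
    regroup : ∀ a b δ p q → b * q + (a + δ * b) * p ≡ a * p + b * (δ * p + q)
    regroup = solve-∀

  seq-ofℤ : ∀ c n → seq (ofℤ c) n ≡ c * Dℤ n
  seq-ofℤ c n = drop c (Dℤ n) (Dℤ (suc n))
    where
    drop : ∀ c p q → c * p + 0ℤ * q ≡ c * p
    drop = solve-∀

  seq-0 : ∀ a b → seq (a , b) 0 ≡ b
  seq-0 a b = simplify a b
    where
    simplify : ∀ a b → a * 0ℤ + b * 1ℤ ≡ b
    simplify = solve-∀

  seq-zero : ∀ x → seq x 0 ≡ 0ℤ → seq x 1 ≡ 0ℤ → x ≡ 0ᴱ
  seq-zero (a , b) s₀ s₁ = cong₂ _,_ a≡0 b≡0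
    where
    b≡0 : b ≡ 0ℤ
    b≡0 = trans (sym (seq-0 a b)) s₀
    a≡0 : a ≡ 0ℤ
    a≡0 = begin
      a                      ≡⟨ sym (trans (cong (λ u → a + u) (*-zeroʳ δ)) (+-identityʳ a)) ⟩
      a + δ * 0ℤ             ≡⟨ cong (λ u → a + δ * u) (sym b≡0) ⟩
      a + δ * b              ≡⟨ sym (seq-0 b (a + δ * b)) ⟩
      seq (α· (a , b)) 0     ≡⟨ seq-α (a , b) 0 ⟩
      seq (a , b) 1          ≡⟨ s₁ ⟩
      0ℤ                     ∎
      where open ≡-Reasoning

  -- For the sign conditions used below this persists along linear sequences (later-≤),
  -- so it means "eventually P".
  Eventually : (ℤ → Set) → (ℕ → ℤ) → Set
  Eventually P t = Σ[ n ∈ ℕ ] P (t n) × P (t (suc n))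

  record Pos (x : Elt) : Set where
    constructor mkPos
    field eventually-pos : Eventually (0ℤ <_) (seq x)

  record NonNeg (x : Elt) : Set where
    constructor mkNonNeg
    field eventually-nonNeg : Eventually (0ℤ ≤_) (seq x)

  _<ₛ_ _≤ₛ_ : Elt → Elt → Set
  x <ₛ y = Pos (y -ᴱ x)
  x ≤ₛ y = NonNeg (y -ᴱ x)

  1ᴱ : Elt
  1ᴱ = ofℤ 1ℤ

  RecClosed : (ℤ → Set) → Set
  RecClosed P = ∀ u v → P u → P v → P (δ * v + u)

  <-recClosed : RecClosed (0ℤ <_)
  <-recClosed u v 0<u 0<v = subst (0ℤ <_) (+-comm u (δ * v)) (0<i+j 0<u (<⇒≤ (0<i*j {δ} {v} 0<δ 0<v)))

  ≤-recClosed : RecClosed (0ℤ ≤_)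
  ≤-recClosed u v 0≤u 0≤v = 0≤i+j {δ * v} {u} (0≤i*j {δ} {v} (<⇒≤ 0<δ) 0≤v) 0≤u

  module _ {P : ℤ → Set} (closed : RecClosed P) {t : ℕ → ℤ} (lin : Linear t) where

    later : ∀ {n} → P (t n) → P (t (suc n)) → ∀ k → P (t (k ℕ.+ n)) × P (t (suc (k ℕ.+ n)))
    later p q zero = p , q
    later {n} p q (suc k) with later p q k
    ... | p′ , q′ = q′ , subst P (sym (lin (k ℕ.+ n))) (closed (t (k ℕ.+ n)) (t (suc (k ℕ.+ n))) p′ q′)

    later-≤ : ∀ {n m} → n ℕ.≤ m → P (t n) → P (t (suc n)) → P (t m) × P (t (suc m))
    later-≤ {n} {m} n≤m p q = subst (λ i → P (t i) × P (t (suc i))) (ℕₚ.m∸n+n≡m n≤m) (later p q (m ℕ.∸ n))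

  synchronize : ∀ {P Q t s} → RecClosed P → RecClosed Q → Linear t → Linear s →
                Eventually P t → Eventually Q s →
                Σ[ m ∈ ℕ ] (P (t m) × P (t (suc m))) × (Q (s m) × Q (s (suc m)))
  synchronize cP cQ lt ls (n , p , p′) (k , q , q′) =
    n ℕ.+ k , later-≤ cP lt (ℕₚ.m≤m+n n k) p p′ , later-≤ cQ ls (ℕₚ.m≤n+m k n) q q′

  Eventually-+ : ∀ {P Q R : ℤ → Set} → RecClosed P → RecClosed Q → (∀ u v → P u → Q v → R (u + v)) →
                 ∀ {x y} → Eventually P (seq x) → Eventually Q (seq y) → Eventually R (seq (x +ᴱ y))
  Eventually-+ {R = R} cP cQ add {x} {y} ex ey with synchronize cP cQ (seq-linear x) (seq-linear y) ex ey
  ... | m , (p , p′) , (q , q′) = m , subst R (sym (seq-+ x y m)) (add (seq x m) (seq y m) p q)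
                                    , subst R (sym (seq-+ x y (suc m))) (add (seq x (suc m)) (seq y (suc m)) p′ q′)

  Pos-+ : ∀ {x y} → Pos x → Pos y → Pos (x +ᴱ y)
  Pos-+ {x} {y} (mkPos p) (mkPos q) =
    mkPos (Eventually-+ {0ℤ <_} {0ℤ <_} {0ℤ <_} <-recClosed <-recClosed (λ _ _ p q → 0<i+j p (<⇒≤ q)) {x} {y} p q)

  Pos-+-NonNeg : ∀ {x y} → Pos x → NonNeg y → Pos (x +ᴱ y)
  Pos-+-NonNeg {x} {y} (mkPos p) (mkNonNeg q) =
    mkPos (Eventually-+ {0ℤ <_} {0ℤ ≤_} {0ℤ <_} <-recClosed ≤-recClosed (λ _ _ → 0<i+j) {x} {y} p q)

  NonNeg-+-Pos : ∀ {x y} → NonNeg x → Pos y → Pos (x +ᴱ y)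
  NonNeg-+-Pos {x} {y} nx py = subst Pos (+ᴱ-comm y x) (Pos-+-NonNeg py nx)

  NonNeg-+ : ∀ {x y} → NonNeg x → NonNeg y → NonNeg (x +ᴱ y)
  NonNeg-+ {x} {y} (mkNonNeg p) (mkNonNeg q) =
    mkNonNeg (Eventually-+ {0ℤ ≤_} {0ℤ ≤_} {0ℤ ≤_} ≤-recClosed ≤-recClosed (λ _ _ → 0≤i+j) {x} {y} p q)

  Pos⇒NonNeg : ∀ {x} → Pos x → NonNeg x
  Pos⇒NonNeg (mkPos (n , p , q)) = mkNonNeg (n , <⇒≤ p , <⇒≤ q)

  NonNeg⇒¬Pos-neg : ∀ {x} → NonNeg x → ¬ Pos (negᴱ x)
  NonNeg⇒¬Pos-neg {x} (mkNonNeg nx) (mkPos px) with synchronize ≤-recClosed <-recClosed (seq-linear x) (seq-linear (negᴱ x)) nx px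
  ... | m , (0≤x , _) , (0<-x , _) = <⇒≱ (subst (0ℤ <_) (seq-neg x m) 0<-x) (neg-mono-≤ 0≤x)

  Eventually-α⁻ : ∀ {P x} → Eventually P (seq (α· x)) → Eventually P (seq x)
  Eventually-α⁻ {P} {x} (n , p , q) = suc n , subst P (seq-α x n) p , subst P (seq-α x (suc n)) q

  Eventually-α : ∀ {P} → RecClosed P → ∀ {x} → Eventually P (seq x) → Eventually P (seq (α· x))
  Eventually-α {P} closed {x} (n , p , q) =
    n , subst P (sym (seq-α x n)) q , subst P (sym (seq-α x (suc n))) (proj₂ (later closed (seq-linear x) {n} p q 1))

  Eventually-α⁻¹ : ∀ {P} → RecClosed P → ∀ {x} → Eventually P (seq x) → Eventually P (seq (α⁻¹· x))
  Eventually-α⁻¹ {P} closed {x} ex = Eventually-α⁻ {P} {α⁻¹· x} (subst (λ y → Eventually P (seq y)) (sym (α·α⁻¹· x)) ex)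

  Pos-ofℤ : ∀ {c} → 0ℤ < c → Pos (ofℤ c)
  Pos-ofℤ {c} 0<c = mkPos (1 , positive-at 0 , positive-at 1)
    where
    positive-at : ∀ n → 0ℤ < seq (ofℤ c) (suc n)
    positive-at n = subst (0ℤ <_) (sym (seq-ofℤ c (suc n))) (0<i*j {c} {Dℤ (suc n)} 0<c (+<+ (0<D n)))

  NonNeg-ofℤ : ∀ {c} → 0ℤ ≤ c → NonNeg (ofℤ c)
  NonNeg-ofℤ {c} 0≤c = mkNonNeg (0 , nonNegative-at 0 , nonNegative-at 1)
    where
    nonNegative-at : ∀ n → 0ℤ ≤ seq (ofℤ c) n
    nonNegative-at n = subst (0ℤ ≤_) (sym (seq-ofℤ c n)) (0≤i*j {c} {Dℤ n} 0≤c (+≤+ z≤n))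

  Pos-ofℤ⁻ : ∀ {c} → Pos (ofℤ c) → 0ℤ < c
  Pos-ofℤ⁻ {c} (mkPos (n , _ , p)) = 0<i*j⇒0<i {c} {Dℤ (suc n)} (+≤+ z≤n) (subst (0ℤ <_) (seq-ofℤ c (suc n)) p)

  NonNeg-ofℤ⁻ : ∀ {c} → NonNeg (ofℤ c) → 0ℤ ≤ c
  NonNeg-ofℤ⁻ {c} (mkNonNeg (n , _ , p)) = 0≤i*j⇒0≤i {c} {Dℤ (suc n)} (+<+ (0<D n)) (subst (0ℤ ≤_) (seq-ofℤ c (suc n)) p)

  Pos-α : ∀ {x} → Pos x → Pos (α· x)
  Pos-α {x} (mkPos p) = mkPos (Eventually-α <-recClosed {x} p)

  NonNeg-α : ∀ {x} → NonNeg x → NonNeg (α· x)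
  NonNeg-α {x} (mkNonNeg p) = mkNonNeg (Eventually-α ≤-recClosed {x} p)

  Pos-α⁻¹ : ∀ {x} → Pos x → Pos (α⁻¹· x)
  Pos-α⁻¹ {x} (mkPos p) = mkPos (Eventually-α⁻¹ <-recClosed {x} p)

  NonNeg-α⁻ : ∀ {x} → NonNeg (α· x) → NonNeg x
  NonNeg-α⁻ {x} (mkNonNeg p) = mkNonNeg (Eventually-α⁻ {0ℤ ≤_} {x} p)

  Signed : (ℕ → ℤ) → Set
  Signed t = Eventually (0ℤ <_) t ⊎ Eventually (_< 0ℤ) t

  Signed-neg : ∀ {t} → Signed (λ n → - t n) → Signed t
  Signed-neg {t} (inj₁ (n , p , q)) = inj₂ (n , neg-cancel-< {0ℤ} {t n} p , neg-cancel-< {0ℤ} {t (suc n)} q)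
  Signed-neg {t} (inj₂ (n , p , q)) = inj₁ (n , neg-cancel-< {t n} {0ℤ} p , neg-cancel-< {t (suc n)} {0ℤ} q)

  δ*-neg : ∀ {u} → u < 0ℤ → δ * u < 0ℤ
  δ*-neg {u} u<0 = subst (δ * u <_) (*-zeroʳ δ) (*-monoˡ-<-pos δ {{positive 0<δ}} u<0)

  Signed-δ : ∀ {t} m {u} → t m ≡ u → t (suc m) ≡ δ * u → u ≢ 0ℤ → Signed t
  Signed-δ {t} m {u} tm≡u tm+1≡δu u≢0 with <-cmp u 0ℤ
  ... | tri< u<0 _ _ = inj₂ (m , subst (_< 0ℤ) (sym tm≡u) u<0 , subst (_< 0ℤ) (sym tm+1≡δu) (δ*-neg u<0))
  ... | tri≈ _ u≡0 _ = ⊥-elim (u≢0 u≡0)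
  ... | tri> _ _ 0<u = inj₁ (m , subst (0ℤ <_) (sym tm≡u) 0<u , subst (0ℤ <_) (sym tm+1≡δu) (0<i*j {δ} {u} 0<δ 0<u))

  module _ {t : ℕ → ℤ} (lin : Linear t) where

    Signed-after-zero : ∀ n → t n ≡ 0ℤ → t (suc n) ≢ 0ℤ → Signed t
    Signed-after-zero n tn≡0 = Signed-δ (suc n) refl (begin
      t (suc (suc n))       ≡⟨ lin n ⟩
      δ * t (suc n) + t n   ≡⟨ cong (λ u → δ * t (suc n) + u) tn≡0 ⟩
      δ * t (suc n) + 0ℤ    ≡⟨ +-identityʳ _ ⟩
      δ * t (suc n)         ∎)
      where open ≡-Reasoning

    Signed-before-zero : ∀ n → t (suc n) ≡ 0ℤ → t n ≢ 0ℤ → Signed t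
    Signed-before-zero n tn+1≡0 = Signed-δ (suc (suc n)) tn+2≡tn (begin
      t (suc (suc (suc n)))                ≡⟨ lin (suc n) ⟩
      δ * t (suc (suc n)) + t (suc n)      ≡⟨ cong₂ (λ u v → δ * u + v) tn+2≡tn tn+1≡0 ⟩
      δ * t n + 0ℤ                         ≡⟨ +-identityʳ _ ⟩
      δ * t n                              ∎)
      where
      open ≡-Reasoning
      tn+2≡tn : t (suc (suc n)) ≡ t n
      tn+2≡tn = begin
        t (suc (suc n))      ≡⟨ lin n ⟩
        δ * t (suc n) + t n  ≡⟨ cong (λ u → δ * u + t n) tn+1≡0 ⟩
        δ * 0ℤ + t n         ≡⟨ cong (_+ t n) (*-zeroʳ δ) ⟩
        0ℤ + t n             ≡⟨ +-identityˡ (t n) ⟩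
        t n                  ∎

  -- Two consecutive terms of opposite signs are followed by a pair whose absolute
  -- values have a smaller sum, since t (n+2) = δ t (n+1) + t n lies strictly below t n.
  mutual
    descend : ∀ fuel {t} → Linear t → ∀ n → ∣ t n ∣ ℕ.+ ∣ t (suc n) ∣ ℕ.< fuel →
              ¬ (t n ≡ 0ℤ × t (suc n) ≡ 0ℤ) → Signed t
    descend fuel {t} lin n bound nonzero with <-cmp (t n) 0ℤ | <-cmp (t (suc n)) 0ℤ
    ... | tri> _ _ p | tri> _ _ q = inj₁ (n , p , q)
    ... | tri< p _ _ | tri< q _ _ = inj₂ (n , p , q)
    ... | tri≈ _ p _ | _          = Signed-after-zero lin n p (λ q → nonzero (p , q))
    ... | _          | tri≈ _ q _ = Signed-before-zero lin n q (λ p → nonzero (p , q))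
    ... | tri> _ _ p | tri< q _ _ = descend-mixed fuel lin n bound p q
    ... | tri< p _ _ | tri> _ _ q =
      Signed-neg (descend-mixed fuel (Linear-neg lin) n bound′ (neg-mono-< p) (neg-mono-< q))
      where
      bound′ : ∣ - t n ∣ ℕ.+ ∣ - t (suc n) ∣ ℕ.< fuel
      bound′ = subst₂ (λ u v → u ℕ.+ v ℕ.< fuel) (sym (∣-i∣≡∣i∣ (t n))) (sym (∣-i∣≡∣i∣ (t (suc n)))) bound

    descend-mixed : ∀ fuel {t} → Linear t → ∀ n → ∣ t n ∣ ℕ.+ ∣ t (suc n) ∣ ℕ.< fuel →
                    0ℤ < t n → t (suc n) < 0ℤ → Signed t
    descend-mixed (suc fuel) {t} lin n bound 0<tn tn+1<0 with <-cmp (t (suc (suc n))) 0ℤ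
    ... | tri< r _ _ = inj₂ (suc n , tn+1<0 , r)
    ... | tri≈ _ r _ = Signed-before-zero lin (suc n) r (<⇒≢ tn+1<0)
    ... | tri> _ _ r = descend fuel lin (suc n) bound′ (λ z → <⇒≢ tn+1<0 (proj₁ z))
      where
      tn+2<tn : t (suc (suc n)) < t n
      tn+2<tn = subst (_< t n) (sym (lin n))
                  (subst (δ * t (suc n) + t n <_) (+-identityˡ (t n)) (+-monoˡ-< (t n) (δ*-neg tn+1<0)))
      smaller : ∣ t (suc (suc n)) ∣ ℕ.< ∣ t n ∣
      smaller = drop‿+<+ (subst₂ _<_ (sym (0≤i⇒+∣i∣≡i (<⇒≤ r))) (sym (0≤i⇒+∣i∣≡i (<⇒≤ 0<tn))) tn+2<tn)
      bound′ : ∣ t (suc n) ∣ ℕ.+ ∣ t (suc (suc n)) ∣ ℕ.< fuel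
      bound′ = ℕₚ.<-≤-trans (ℕₚ.+-monoʳ-< ∣ t (suc n) ∣ smaller)
                 (subst (ℕ._≤ fuel) (ℕₚ.+-comm ∣ t n ∣ ∣ t (suc n) ∣) (ℕₚ.≤-pred bound))

  Signed⇒trichotomy : ∀ x → Signed (seq x) → Pos x ⊎ x ≡ 0ᴱ ⊎ Pos (negᴱ x)
  Signed⇒trichotomy x (inj₁ p) = inj₁ (mkPos p)
  Signed⇒trichotomy x (inj₂ (m , p , q)) = inj₂ (inj₂ (mkPos (m , flip m p , flip (suc m) q)))
    where
    flip : ∀ n → seq x n < 0ℤ → 0ℤ < seq (negᴱ x) n
    flip n p = subst (0ℤ <_) (sym (seq-neg x n)) (neg-mono-< p)

  trichotomy : ∀ x → Pos x ⊎ x ≡ 0ᴱ ⊎ Pos (negᴱ x)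
  trichotomy x with (seq x 0 ≟ 0ℤ) ×-dec (seq x 1 ≟ 0ℤ)
  ... | yes (s₀ , s₁) = inj₂ (inj₁ (seq-zero x s₀ s₁))
  ... | no nonzero = Signed⇒trichotomy x (descend _ (seq-linear x) 0 (ℕₚ.n<1+n _) nonzero)

  -- Comparison with the order used in FracCond

  -- 2x = ratPart x + b √S for x = (a , b), and L n ≈ √S Dₙ is the companion sequence of D.
  ratPart : Elt → ℤ
  ratPart (a , b) = + 2 * a + b * δ

  L : ℕ → ℤ
  L n = + 2 * Dℤ (suc n) - δ * Dℤ n

  cassini : ℕ → ℤ
  cassini n = Dℤ (suc n) * Dℤ (suc n) - δ * Dℤ (suc n) * Dℤ n - Dℤ n * Dℤ n

  cassini-suc : ∀ n → cassini (suc n) ≡ - cassini n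
  cassini-suc n = begin
    cassini (suc n)                 ≡⟨ cong (λ u → u * u - δ * u * p - p * p) (D-linear n) ⟩
    (δ * p + q) * (δ * p + q) - δ * (δ * p + q) * p - p * p
                                    ≡⟨ expand δ p q ⟩
    - cassini n                     ∎
    where
    open ≡-Reasoning
    p = Dℤ (suc n)
    q = Dℤ n
    expand : ∀ δ p q → (δ * p + q) * (δ * p + q) - δ * (δ * p + q) * p - p * p ≡ - (p * p - δ * p * q - q * q)
    expand = solve-∀

  cassini-even : ∀ k → cassini (k ℕ.+ k) ≡ + 1
  cassini-even zero = cancel δ
    where
    cancel : ∀ δ → 1ℤ * 1ℤ - δ * 1ℤ * 0ℤ - 0ℤ * 0ℤ ≡ 1ℤ
    cancel = solve-∀
  cassini-even (suc k) = begin
    cassini (suc (k ℕ.+ suc k))   ≡⟨ cong (λ i → cassini (suc i)) (ℕₚ.+-suc k k) ⟩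
    cassini (suc (suc (k ℕ.+ k))) ≡⟨ cassini-suc (suc (k ℕ.+ k)) ⟩
    - cassini (suc (k ℕ.+ k))     ≡⟨ cong -_ (cassini-suc (k ℕ.+ k)) ⟩
    - - cassini (k ℕ.+ k)         ≡⟨ neg-involutive _ ⟩
    cassini (k ℕ.+ k)             ≡⟨ cassini-even k ⟩
    + 1                           ∎
    where open ≡-Reasoning

  cassini-odd : ∀ k → cassini (suc (k ℕ.+ k)) ≡ -1ℤ
  cassini-odd k = trans (cassini-suc (k ℕ.+ k)) (cong -_ (cassini-even k))

  S≡δ²+4 : S ≡ δ * δ + + 4
  S≡δ²+4 = trans (pos-+ (d ℕ.* d) 4) (cong (_+ + 4) (pos-* d d))

  L² : ∀ n → L n * L n ≡ S * (Dℤ n * Dℤ n) + + 4 * cassini n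
  L² n = trans (expand δ (Dℤ (suc n)) (Dℤ n)) (cong (λ s → s * (Dℤ n * Dℤ n) + + 4 * cassini n) (sym S≡δ²+4))
    where
    expand : ∀ δ p q → (+ 2 * p - δ * q) * (+ 2 * p - δ * q) ≡
                       (δ * δ + + 4) * (q * q) + + 4 * (p * p - δ * p * q - q * q)
    expand = solve-∀

  0<L : ∀ n → 0ℤ < L n
  0<L zero = subst (0ℤ <_) (sym (simplify δ)) (+<+ (s≤s z≤n))
    where
    simplify : ∀ δ → + 2 * 1ℤ - δ * 0ℤ ≡ + 2
    simplify = solve-∀
  0<L (suc n) = subst (0ℤ <_) (sym L-suc) (0<i+j (+<+ (0<D (suc n))) (+≤+ z≤n))
    where
    L-suc : L (suc n) ≡ Dℤ (suc (suc n)) + Dℤ n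
    L-suc = begin
      + 2 * Dℤ (suc (suc n)) - δ * Dℤ (suc n)       ≡⟨ cong (λ u → + 2 * u - δ * Dℤ (suc n)) (D-linear n) ⟩
      + 2 * (δ * Dℤ (suc n) + Dℤ n) - δ * Dℤ (suc n) ≡⟨ regroup δ (Dℤ (suc n)) (Dℤ n) ⟩
      (δ * Dℤ (suc n) + Dℤ n) + Dℤ n                 ≡⟨ cong (_+ Dℤ n) (sym (D-linear n)) ⟩
      Dℤ (suc (suc n)) + Dℤ n                        ∎
      where
      open ≡-Reasoning
      regroup : ∀ δ p q → + 2 * (δ * p + q) - δ * p ≡ (δ * p + q) + q
      regroup = solve-∀

  twice-seq : ∀ x n → + 2 * seq x n ≡ ratPart x * Dℤ n + proj₂ x * L n
  twice-seq (a , b) n = regroup a b δ (Dℤ (suc n)) (Dℤ n)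
    where
    regroup : ∀ a b δ p q → + 2 * (a * q + b * p) ≡ (+ 2 * a + b * δ) * q + b * (+ 2 * p - δ * q)
    regroup = solve-∀

  gap⇒0<Δ : ∀ {X Y Δ P B} → 0ℤ ≤ Y → Y < X → X * X - Y * Y ≡ Δ * P - + 4 * B * + 1 →
            0ℤ ≤ B → 0ℤ ≤ P → 0ℤ < Δ
  gap⇒0<Δ {X} {Y} {Δ} {P} {B} 0≤Y Y<X gap 0≤B 0≤P = 0<i*j⇒0<i 0≤P (subst (0ℤ <_) (regroup (Δ * P) (+ 4 * B))
      (0<i+j (subst (0ℤ <_) gap (i<j⇒0<j-i (0≤i<j⇒i*i<j*j 0≤Y Y<X))) (0≤i*j {+ 4} {B} (+≤+ z≤n) 0≤B)))
    where
    regroup : ∀ u v → (u - v * + 1) + v ≡ u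
    regroup = solve-∀

  squares-cD-bL : ∀ c b n → (c * Dℤ n) * (c * Dℤ n) - (- b * L n) * (- b * L n) ≡
                            (c * c - b * b * S) * (Dℤ n * Dℤ n) - + 4 * (b * b) * cassini n
  squares-cD-bL c b n = begin
    (c * Dℤ n) * (c * Dℤ n) - (- b * L n) * (- b * L n)    ≡⟨ expand c b (Dℤ n) (L n) ⟩
    c * c * (Dℤ n * Dℤ n) - b * b * (L n * L n)            ≡⟨ cong (λ u → c * c * (Dℤ n * Dℤ n) - b * b * u) (L² n) ⟩
    c * c * (Dℤ n * Dℤ n) - b * b * (S * (Dℤ n * Dℤ n) + + 4 * cassini n)
                                                           ≡⟨ collect c b (Dℤ n) S (cassini n) ⟩
    (c * c - b * b * S) * (Dℤ n * Dℤ n) - + 4 * (b * b) * cassini n ∎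
    where
    open ≡-Reasoning
    expand : ∀ c b D L → (c * D) * (c * D) - (- b * L) * (- b * L) ≡ c * c * (D * D) - b * b * (L * L)
    expand = solve-∀
    collect : ∀ c b D S k → c * c * (D * D) - b * b * (S * (D * D) + + 4 * k) ≡ (c * c - b * b * S) * (D * D) - + 4 * (b * b) * k
    collect = solve-∀

  squares-bL-cD : ∀ c b n → (b * L n) * (b * L n) - (- c * Dℤ n) * (- c * Dℤ n) ≡
                            (b * b * S - c * c) * (Dℤ n * Dℤ n) - + 4 * (b * b) * - cassini n
  squares-bL-cD c b n = begin
    (b * L n) * (b * L n) - (- c * Dℤ n) * (- c * Dℤ n)    ≡⟨ expand c b (Dℤ n) (L n) ⟩
    b * b * (L n * L n) - c * c * (Dℤ n * Dℤ n)            ≡⟨ cong (λ u → b * b * u - c * c * (Dℤ n * Dℤ n)) (L² n) ⟩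
    b * b * (S * (Dℤ n * Dℤ n) + + 4 * cassini n) - c * c * (Dℤ n * Dℤ n)
                                                           ≡⟨ collect c b (Dℤ n) S (cassini n) ⟩
    (b * b * S - c * c) * (Dℤ n * Dℤ n) - + 4 * (b * b) * - cassini n ∎
    where
    open ≡-Reasoning
    expand : ∀ c b D L → (b * L) * (b * L) - (- c * D) * (- c * D) ≡ b * b * (L * L) - c * c * (D * D)
    expand = solve-∀
    collect : ∀ c b D S k → b * b * (S * (D * D) + + 4 * k) - c * c * (D * D) ≡ (b * b * S - c * c) * (D * D) - + 4 * (b * b) * - k
    collect = solve-∀

  0<pq+rs⇒-pq<rs : ∀ p q r s → 0ℤ < p * q + r * s → - p * q < r * s
  0<pq+rs⇒-pq<rs p q r s pos = 0<j-i⇒i<j (subst (0ℤ <_) (regroup p q r s) pos)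
    where
    regroup : ∀ p q r s → p * q + r * s ≡ r * s - - p * q
    regroup = solve-∀

  Pos⇒twice-pos : ∀ x {n} → 0ℤ < seq x n → 0ℤ < seq x (suc n) →
                  ∀ m → n ℕ.≤ m → 0ℤ < ratPart x * Dℤ m + proj₂ x * L m
  Pos⇒twice-pos x {n} p q m n≤m =
    subst (0ℤ <_) (twice-seq x m) (0<i*j {+ 2} (+<+ (s≤s z≤n)) (proj₁ (later-≤ <-recClosed (seq-linear x) n≤m p q)))

  -- Squaring c Dₘ > -b Lₘ at an even m, where L² = S D² + 4, gives c² > b² S; odd m give the
  -- symmetric inequality.
  Pos⇒b²S<c² : ∀ x {n} → 0ℤ < seq x n → 0ℤ < seq x (suc n) → proj₂ x < 0ℤ →
               proj₂ x * proj₂ x * S < ratPart x * ratPart x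
  Pos⇒b²S<c² x@(a , b) {n} p q b<0 = 0<j-i⇒i<j $
    gap⇒0<Δ (0≤i*j (<⇒≤ (neg-mono-< b<0)) (<⇒≤ (0<L m)))
            (0<pq+rs⇒-pq<rs b (L m) c (Dℤ m) (subst (0ℤ <_) (+-comm (c * Dℤ m) (b * L m)) (Pos⇒twice-pos x p q m m≥n)))
            (trans (squares-cD-bL c b m) (cong (λ k → (c * c - b * b * S) * (Dℤ m * Dℤ m) - + 4 * (b * b) * k) (cassini-even (suc n))))
            (0≤i*i b) (0≤i*i (Dℤ m))
    where
    c = ratPart x
    m = suc n ℕ.+ suc n
    m≥n : n ℕ.≤ m
    m≥n = ℕₚ.≤-trans (ℕₚ.n≤1+n n) (ℕₚ.m≤m+n (suc n) (suc n))

  Pos⇒c²<b²S : ∀ x {n} → 0ℤ < seq x n → 0ℤ < seq x (suc n) → ratPart x < 0ℤ →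
               ratPart x * ratPart x < proj₂ x * proj₂ x * S
  Pos⇒c²<b²S x@(a , b) {n} p q c<0 = 0<j-i⇒i<j $
    gap⇒0<Δ (0≤i*j (<⇒≤ (neg-mono-< c<0)) (+≤+ z≤n))
            (0<pq+rs⇒-pq<rs c (Dℤ m) b (L m) (Pos⇒twice-pos x p q m m≥n))
            (trans (squares-bL-cD c b m) (cong (λ k → (b * b * S - c * c) * (Dℤ m * Dℤ m) - + 4 * (b * b) * k) (cong -_ (cassini-odd (suc n)))))
            (0≤i*i b) (0≤i*i (Dℤ m))
    where
    c = ratPart x
    m = suc (suc n ℕ.+ suc n)
    m≥n : n ℕ.≤ m
    m≥n = ℕₚ.≤-trans (ℕₚ.n≤1+n n) (ℕₚ.≤-trans (ℕₚ.m≤m+n (suc n) (suc n)) (ℕₚ.n≤1+n _))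

  Pos⇒¬nonPos : ∀ x {n} → 0ℤ < seq x n → 0ℤ < seq x (suc n) → ratPart x ≤ 0ℤ → proj₂ x ≤ 0ℤ → ⊥
  Pos⇒¬nonPos x@(a , b) {n} p q c≤0 b≤0 = <⇒≱ (Pos⇒twice-pos x p q (suc n) (ℕₚ.n≤1+n n))
    (subst (ratPart x * Dℤ (suc n) + b * L (suc n) ≤_) (+-identityʳ 0ℤ)
      (+-mono-≤ (i*j≤0 c≤0 (+≤+ z≤n)) (i*j≤0 b≤0 (<⇒≤ (0<L (suc n))))))

  Pos⇒Posᴱ : ∀ x → Pos x → Posᴱ x
  Pos⇒Posᴱ x@(a , b) (mkPos (n , p , q)) with 0ℤ <? ratPart x | <-cmp b 0ℤ
  ... | yes 0<c | tri> _ _ 0<b = inj₁ (0<c , <⇒≤ 0<b)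
  ... | yes 0<c | tri≈ _ b≡0 _ = inj₁ (0<c , ≤-reflexive (sym b≡0))
  ... | yes 0<c | tri< b<0 _ _ = inj₂ (inj₂ (inj₁ (0<c , b<0 , Pos⇒b²S<c² x {n} p q b<0)))
  ... | no c≮0 | tri≈ _ b≡0 _ = ⊥-elim (Pos⇒¬nonPos x {n} p q (≮⇒≥ c≮0) (≤-reflexive b≡0))
  ... | no c≮0 | tri< b<0 _ _ = ⊥-elim (Pos⇒¬nonPos x {n} p q (≮⇒≥ c≮0) (<⇒≤ b<0))
  ... | no c≮0 | tri> _ _ 0<b with <-cmp (ratPart x) 0ℤ
  ...   | tri< c<0 _ _ = inj₂ (inj₂ (inj₂ (c<0 , 0<b , Pos⇒c²<b²S x {n} p q c<0)))
  ...   | tri≈ _ c≡0 _ = inj₂ (inj₁ (≤-reflexive (sym c≡0) , 0<b))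
  ...   | tri> _ _ 0<c = ⊥-elim (c≮0 0<c)

  PosS⇒NonNegS : ∀ {c b} → PosS c b → NonNegS c b
  PosS⇒NonNegS (inj₁ (p , q)) = inj₁ (<⇒≤ p , q)
  PosS⇒NonNegS (inj₂ (inj₁ (p , q))) = inj₁ (p , <⇒≤ q)
  PosS⇒NonNegS (inj₂ (inj₂ (inj₁ (p , q , r)))) = inj₂ (inj₁ (<⇒≤ p , q , <⇒≤ r))
  PosS⇒NonNegS (inj₂ (inj₂ (inj₂ (p , q , r)))) = inj₂ (inj₂ (p , <⇒≤ q , <⇒≤ r))

  PosS⇒0<c⊎0<b : ∀ {c b} → PosS c b → 0ℤ < c ⊎ 0ℤ < b
  PosS⇒0<c⊎0<b (inj₁ (p , _)) = inj₁ p
  PosS⇒0<c⊎0<b (inj₂ (inj₁ (_ , q))) = inj₂ q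
  PosS⇒0<c⊎0<b (inj₂ (inj₂ (inj₁ (p , _)))) = inj₁ p
  PosS⇒0<c⊎0<b (inj₂ (inj₂ (inj₂ (_ , q , _)))) = inj₂ q

  0<S : 0ℤ < S
  0<S = +<+ (ℕₚ.<-≤-trans (s≤s z≤n) (ℕₚ.m≤n+m 4 (d ℕ.* d)))

  NonNegS⇒¬PosS-neg : ∀ {c b} → NonNegS c b → ¬ PosS (- c) (- b)
  NonNegS⇒¬PosS-neg {c} {b} (inj₁ (0≤c , 0≤b)) pos with PosS⇒0<c⊎0<b pos
  ... | inj₁ 0<-c = <⇒≱ (neg-cancel-< {0ℤ} {c} 0<-c) 0≤c
  ... | inj₂ 0<-b = <⇒≱ (neg-cancel-< {0ℤ} {b} 0<-b) 0≤b
  NonNegS⇒¬PosS-neg {c} {b} (inj₂ (inj₁ (0≤c , b<0 , b²S≤c²))) pos with pos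
  ... | inj₁ (0<-c , _) = <⇒≱ (neg-cancel-< {0ℤ} {c} 0<-c) 0≤c
  ... | inj₂ (inj₁ (0≤-c , _)) = <⇒≱ (0<i*j (0<i*i (<⇒≢ b<0)) 0<S) (subst (b * b * S ≤_) c²≡0 b²S≤c²)
    where
    c²≡0 : c * c ≡ 0ℤ
    c²≡0 = cong (λ u → u * u) (≤-antisym (neg-cancel-≤ {0ℤ} {c} 0≤-c) 0≤c)
  ... | inj₂ (inj₂ (inj₁ (0<-c , _))) = <⇒≱ (neg-cancel-< {0ℤ} {c} 0<-c) 0≤c
  ... | inj₂ (inj₂ (inj₂ (_ , _ , c²<b²S))) =
    <⇒≱ (subst₂ _<_ (-i*-i≡i*i c) (cong (_* S) (-i*-i≡i*i b)) c²<b²S) b²S≤c²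
  NonNegS⇒¬PosS-neg {c} {b} (inj₂ (inj₂ (c<0 , 0≤b , c²≤b²S))) pos with pos
  ... | inj₁ (_ , 0≤-b) = <⇒≱ (0<i*i (<⇒≢ c<0)) (subst (c * c ≤_) b²S≡0 c²≤b²S)
    where
    b²S≡0 : b * b * S ≡ 0ℤ
    b²S≡0 = trans (cong (λ u → u * u * S) (≤-antisym (neg-cancel-≤ {0ℤ} {b} 0≤-b) 0≤b)) (*-zeroˡ S)
  ... | inj₂ (inj₁ (_ , 0<-b)) = <⇒≱ (neg-cancel-< {0ℤ} {b} 0<-b) 0≤b
  ... | inj₂ (inj₂ (inj₁ (_ , _ , b²S<c²))) =
    <⇒≱ (subst₂ _<_ (cong (_* S) (-i*-i≡i*i b)) (-i*-i≡i*i c) b²S<c²) c²≤b²S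
  ... | inj₂ (inj₂ (inj₂ (-c<0 , _))) = <⇒≱ (neg-mono-< c<0) (<⇒≤ -c<0)

  ratPart-neg : ∀ x → ratPart (negᴱ x) ≡ - ratPart x
  ratPart-neg (a , b) = negate a b δ
    where
    negate : ∀ a b δ → + 2 * - a + - b * δ ≡ - (+ 2 * a + b * δ)
    negate = solve-∀

  NonNegᴱ⇒NonNeg : ∀ x → NonNegᴱ x → NonNeg x
  NonNegᴱ⇒NonNeg x nonNeg with trichotomy x
  ... | inj₁ p = Pos⇒NonNeg p
  ... | inj₂ (inj₁ refl) = NonNeg-ofℤ ≤-refl
  ... | inj₂ (inj₂ p) = ⊥-elim (NonNegS⇒¬PosS-neg nonNeg (subst (λ c → PosS c (- proj₂ x)) (ratPart-neg x) (Pos⇒Posᴱ (negᴱ x) p)))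

  NonNeg⇒NonNegᴱ : ∀ x → NonNeg x → NonNegᴱ x
  NonNeg⇒NonNegᴱ x nonNeg with trichotomy x
  ... | inj₁ p = PosS⇒NonNegS (Pos⇒Posᴱ x p)
  ... | inj₂ (inj₁ refl) = inj₁ (≤-refl , ≤-refl)
  ... | inj₂ (inj₂ p) = ⊥-elim (NonNeg⇒¬Pos-neg nonNeg p)

  -- Ostrowski words and the window of F

  valFrom-linear : ∀ k w → valFrom (suc (suc k)) w ≡ d ℕ.* valFrom (suc k) w ℕ.+ valFrom k w
  valFrom-linear k [] = sym (trans (ℕₚ.+-identityʳ (d ℕ.* 0)) (ℕₚ.*-zeroʳ d))
  valFrom-linear k (x ∷ w) rewrite valFrom-linear (suc k) w = distribute x d (D (suc k)) (D k) (valFrom (suc (suc k)) w) (valFrom (suc k) w)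
    where
    open ℕ-Solver
    distribute : ∀ x d p q a b → x ℕ.* (d ℕ.* p ℕ.+ q) ℕ.+ (d ℕ.* a ℕ.+ b) ≡ d ℕ.* (x ℕ.* p ℕ.+ a) ℕ.+ (x ℕ.* q ℕ.+ b)
    distribute = ℕ-Solver.solve 6 (λ x d p q a b → x :* (d :* p :+ q) :+ (d :* a :+ b) := d :* (x :* p :+ a) :+ (x :* q :+ b)) refl

  V H : Word → ℤ
  V u = + valFrom 1 u
  H u = + valFrom 2 u

  V-cons : ∀ x u → V (x ∷ u) ≡ + x + H u
  V-cons x u = trans (pos-+ (x ℕ.* 1) (valFrom 2 u)) (cong (λ z → + z + H u) (ℕₚ.*-identityʳ x))

  H-cons : ∀ x u → H (x ∷ u) ≡ δ * V (x ∷ u) + V u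
  H-cons x u = begin
    + (x ℕ.* D 2 ℕ.+ valFrom 3 u)                     ≡⟨ cong (λ z → + (x ℕ.* D 2 ℕ.+ z)) (valFrom-linear 1 u) ⟩
    + (x ℕ.* (d ℕ.* 1 ℕ.+ 0) ℕ.+ (d ℕ.* valFrom 2 u ℕ.+ valFrom 1 u)) ≡⟨ cong +_ (regroup x d (valFrom 2 u) (valFrom 1 u)) ⟩
    + (d ℕ.* (x ℕ.* 1 ℕ.+ valFrom 2 u) ℕ.+ valFrom 1 u) ≡⟨ pos-+ _ (valFrom 1 u) ⟩
    + (d ℕ.* valFrom 1 (x ∷ u)) + V u                  ≡⟨ cong (_+ V u) (pos-* d _) ⟩
    δ * V (x ∷ u) + V u                                ∎
    where
    open ≡-Reasoning
    open ℕ-Solver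
    regroup : ∀ x d h v → x ℕ.* (d ℕ.* 1 ℕ.+ 0) ℕ.+ (d ℕ.* h ℕ.+ v) ≡ d ℕ.* (x ℕ.* 1 ℕ.+ h) ℕ.+ v
    regroup = ℕ-Solver.solve 4 (λ x d h v → x :* (d :* con 1 :+ con 0) :+ (d :* h :+ v) := d :* (x :* con 1 :+ h) :+ v) refl

  -- F u = α V u - H u measures how well H u / V u approximates α.
  F : Word → Elt
  F u = - H u , V u

  F-cons : ∀ x u → F (x ∷ u) ≡ (- (δ * (+ x + H u) + V u) , + x + H u)
  F-cons x u = cong₂ _,_ (cong -_ (trans (H-cons x u) (cong (λ v → δ * v + V u) (V-cons x u)))) (V-cons x u)

  0<α⁻¹ : Pos invα
  0<α⁻¹ = subst Pos (cong (_, 1ℤ) (simplify δ)) (Pos-α⁻¹ (Pos-ofℤ (+<+ (s≤s z≤n))))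
    where
    simplify : ∀ δ → 0ℤ - δ * 1ℤ ≡ - δ
    simplify = solve-∀

  α⁻¹<1 : invα <ₛ 1ᴱ
  α⁻¹<1 = subst Pos (cong₂ _,_ (simplify₁ δ) (simplify₂ δ))
    (Pos-α⁻¹ (Pos-+-NonNeg 0<α⁻¹ (NonNeg-ofℤ (i≤j⇒0≤j-i (+≤+ 0<d)))))
    where
    simplify₁ : ∀ δ → 0ℤ + 1ℤ - δ * (- δ + (δ - 1ℤ)) ≡ 1ℤ - - δ
    simplify₁ = solve-∀
    simplify₂ : ∀ δ → - δ + (δ - 1ℤ) ≡ 0ℤ - 1ℤ
    simplify₂ = solve-∀

  Digits : Word → Set
  Digits = All (ℕ._≤ d)

  -- Since F (x ∷ u) = α⁻¹ (x - F u):  F (x ∷ u) + α⁻¹ = α⁻¹ (x + (1 - F u)),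
  -- 1 - F (x ∷ u) = α⁻¹ ((F u + α⁻¹) + (d - x)) and 1 - α⁻¹ - F (x ∷ u) = α⁻¹ ((F u + α⁻¹) + (d - 1 - x)).
  F-lower-step : ∀ x u → α⁻¹· (ofℤ (+ x) +ᴱ (1ᴱ -ᴱ F u)) ≡ F (x ∷ u) -ᴱ (negᴱ invα)
  F-lower-step x u = trans (cong₂ _,_ (first (+ x) (H u) (V u) δ) (second (+ x) (H u))) (cong (_-ᴱ (negᴱ invα)) (sym (F-cons x u)))
    where
    first : ∀ x h v δ → (0ℤ + (0ℤ - v)) - δ * (x + (1ℤ - - h)) ≡ - (δ * (x + h) + v) - - - δ
    first = solve-∀
    second : ∀ x h → x + (1ℤ - - h) ≡ x + h - - 1ℤ
    second = solve-∀

  F-upper-step : ∀ x u → α⁻¹· ((F u -ᴱ negᴱ invα) +ᴱ ofℤ (δ - + x)) ≡ 1ᴱ -ᴱ F (x ∷ u)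
  F-upper-step x u = trans (cong₂ _,_ (first (+ x) (H u) (V u) δ) (second (+ x) (H u) δ)) (cong (1ᴱ -ᴱ_) (sym (F-cons x u)))
    where
    first : ∀ x h v δ → (v - - 1ℤ + 0ℤ) - δ * ((- h - - - δ) + (δ - x)) ≡ 1ℤ - - (δ * (x + h) + v)
    first = solve-∀
    second : ∀ x h δ → (- h - - - δ) + (δ - x) ≡ 0ℤ - (x + h)
    second = solve-∀

  F-upper-step′ : ∀ x u → α⁻¹· ((F u -ᴱ negᴱ invα) +ᴱ ofℤ (δ - 1ℤ - + x)) ≡ (1ᴱ -ᴱ invα) -ᴱ F (x ∷ u)
  F-upper-step′ x u = trans (cong₂ _,_ (first (+ x) (H u) (V u) δ) (second (+ x) (H u) δ)) (cong ((1ᴱ -ᴱ invα) -ᴱ_) (sym (F-cons x u)))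
    where
    first : ∀ x h v δ → (v - - 1ℤ + 0ℤ) - δ * ((- h - - - δ) + (δ - 1ℤ - x)) ≡ (1ℤ - - δ) - - (δ * (x + h) + v)
    first = solve-∀
    second : ∀ x h δ → (- h - - - δ) + (δ - 1ℤ - x) ≡ (0ℤ - 1ℤ) - (x + h)
    second = solve-∀

  mutual
    -α⁻¹<F : ∀ {u} → Digits u → negᴱ invα <ₛ F u
    -α⁻¹<F {[]} [] = subst Pos (cong (_, 1ℤ) (simplify δ)) 0<α⁻¹
      where
      simplify : ∀ δ → - δ ≡ - 0ℤ - - - δ
      simplify = solve-∀
    -α⁻¹<F {x ∷ u} (_ ∷ xs) = subst Pos (F-lower-step x u)
      (Pos-α⁻¹ (NonNeg-+-Pos (NonNeg-ofℤ (+≤+ z≤n)) (F<1 xs)))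

    F<1 : ∀ {u} → Digits u → F u <ₛ 1ᴱ
    F<1 {[]} [] = Pos-ofℤ (+<+ (s≤s z≤n))
    F<1 {x ∷ u} (x≤d ∷ xs) = subst Pos (F-upper-step x u)
      (Pos-α⁻¹ (Pos-+-NonNeg (-α⁻¹<F xs) (NonNeg-ofℤ (i≤j⇒0≤j-i (+≤+ x≤d)))))

  F<1-α⁻¹ : ∀ {x u} → x ℕ.< d → Digits u → F (x ∷ u) <ₛ (1ᴱ -ᴱ invα)
  F<1-α⁻¹ {x} {u} x<d xs = subst Pos (F-upper-step′ x u)
    (Pos-α⁻¹ (Pos-+-NonNeg (-α⁻¹<F xs) (NonNeg-ofℤ 0≤d-1-x)))
    where
    0≤d-1-x : 0ℤ ≤ δ - 1ℤ - + x
    0≤d-1-x = subst (0ℤ ≤_) (regroup δ (+ x)) (i≤j⇒0≤j-i (+≤+ x<d))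
      where
      regroup : ∀ δ x → δ - (1ℤ + x) ≡ δ - 1ℤ - x
      regroup = solve-∀

  -- The window (-α⁻¹ , 1 - α⁻¹) has length 1, so points of it with equal α-parts have equal
  -- integer parts.
  window-≤ : ∀ {h h′ v} → negᴱ invα <ₛ (- h , v) → (- h′ , v) <ₛ (1ᴱ -ᴱ invα) → h ≤ h′
  window-≤ {h} {h′} {v} lower upper = 0≤i-j⇒j≤i (subst (0ℤ ≤_) (pred-suc (h′ - h)) (i<j⇒i≤pred[j] 0<1+h′-h))
    where
    0<1+h′-h : 0ℤ < 1ℤ + (h′ - h)
    0<1+h′-h = Pos-ofℤ⁻ (subst Pos (cong₂ _,_ (first h h′ δ) (second v)) (Pos-+ lower upper))
      where
      first : ∀ h h′ δ → (- h - - - δ) + ((1ℤ - - δ) - - h′) ≡ 1ℤ + (h′ - h)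
      first = solve-∀
      second : ∀ v → (v - - 1ℤ) + ((0ℤ - 1ℤ) - v) ≡ 0ℤ
      second = solve-∀

  OstTail⇒Digits : ∀ {p u} → OstTail p u → Digits u
  OstTail⇒Digits {u = []} _ = []
  OstTail⇒Digits {u = y ∷ u} (y≤d , _ , t) = y≤d ∷ OstTail⇒Digits t

  F<1-α⁻¹-after : ∀ {p u} → p ≢ 0 → OstTail p u → F u <ₛ (1ᴱ -ᴱ invα)
  F<1-α⁻¹-after {u = []} _ _ = subst Pos (cong (_, -1ℤ) (simplify δ)) α⁻¹<1
    where
    simplify : ∀ δ → 1ℤ - - δ ≡ (1ℤ - - δ) - - 0ℤ
    simplify = solve-∀
  F<1-α⁻¹-after {u = y ∷ u} p≢0 (y≤d , y≡d⇒p≡0 , t) = F<1-α⁻¹ y<d (OstTail⇒Digits t)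
    where
    y<d : y ℕ.< d
    y<d = ℕₚ.≤∧≢⇒< y≤d (λ y≡d → p≢0 (y≡d⇒p≡0 y≡d))

  OstWord⇒OstTail : ∀ {v} → OstWord v → OstTail 1 v
  OstWord⇒OstTail {[]} _ = _
  OstWord⇒OstTail {x ∷ v} (x<d , t) = ℕₚ.<⇒≤ x<d , (λ x≡d → ⊥-elim (ℕₚ.<⇒≢ x<d x≡d)) , t

  F-window : ∀ {v} → OstWord v → negᴱ invα <ₛ F v × F v <ₛ (1ᴱ -ᴱ invα)
  F-window ov = -α⁻¹<F (OstTail⇒Digits t) , F<1-α⁻¹-after (λ ()) t
    where t = OstWord⇒OstTail ov

  H-unique : ∀ {v v′} → OstWord v → OstWord v′ → V v ≡ V v′ → H v ≡ H v′
  H-unique {v} {v′} ov ov′ eqV = ≤-antisym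
    (window-≤ {v = V v} (proj₁ (F-window ov)) (subst (λ z → (- H v′ , z) <ₛ (1ᴱ -ᴱ invα)) (sym eqV) (proj₂ (F-window ov′))))
    (window-≤ {v = V v′} (proj₁ (F-window ov′)) (subst (λ z → (- H v , z) <ₛ (1ᴱ -ᴱ invα)) eqV (proj₂ (F-window ov))))

  0<valFrom : ∀ k u → LastNonzero u → 0 ℕ.< valFrom (suc k) u
  0<valFrom k (x ∷ []) x≢0 = ℕₚ.<-≤-trans (ℕₚ.*-mono-< (ℕₚ.n≢0⇒n>0 x≢0) (0<D k)) (ℕₚ.m≤m+n _ _)
  0<valFrom k (x ∷ y ∷ u) lnz = ℕₚ.<-≤-trans (0<valFrom (suc k) (y ∷ u) lnz) (ℕₚ.m≤n+m _ (x ℕ.* D (suc k)))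

  0<V : ∀ {u} → LastNonzero u → 0ℤ < V u
  0<V {u} lnz = +<+ (0<valFrom 0 u lnz)

  0<H : ∀ {u} → LastNonzero u → 0ℤ < H u
  0<H {u} lnz = +<+ (0<valFrom 1 u lnz)

  NoTrailingZero : Word → Set
  NoTrailingZero u = u ≡ [] ⊎ LastNonzero u

  NoTrailingZero-tail : ∀ {x u} → NoTrailingZero (x ∷ u) → NoTrailingZero u
  NoTrailingZero-tail {u = []} _ = inj₁ refl
  NoTrailingZero-tail {u = y ∷ u} (inj₂ lnz) = inj₂ lnz

  NoTrailingZero⇒LastNonzero : ∀ {x u} → NoTrailingZero (x ∷ u) → LastNonzero (x ∷ u)
  NoTrailingZero⇒LastNonzero (inj₂ lnz) = lnz

  digit-≤ : ∀ {x x′ u u′} → Digits u → x′ ≢ 0 → OstTail x′ u′ → V u ≡ V u′ → + x + H u ≡ + x′ + H u′ → x′ ℕ.≤ x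
  digit-≤ {x} {x′} {u} {u′} ds x′≢0 t′ eqV eqX =
    drop‿+≤+ (0≤i-j⇒j≤i (subst (0ℤ ≤_) (sym (a+b≡c+e⇒a-c≡e-b {+ x} {H u} {+ x′} {H u′} eqX)) (i≤j⇒0≤j-i Hu≤Hu′)))
    where
    Hu≤Hu′ : H u ≤ H u′
    Hu≤Hu′ = window-≤ {v = V u} (-α⁻¹<F ds) (subst (λ z → (- H u′ , z) <ₛ (1ᴱ -ᴱ invα)) (sym eqV) (F<1-α⁻¹-after x′≢0 t′))

  tail-unique : ∀ {p p′ u u′} → OstTail p u → OstTail p′ u′ → NoTrailingZero u → NoTrailingZero u′ →
                V u ≡ V u′ → H u ≡ H u′ → u ≡ u′
  tail-unique {u = []} {[]} _ _ _ _ _ _ = refl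
  tail-unique {u = []} {x′ ∷ u′} _ _ _ z′ eqV _ = ⊥-elim (<-irrefl eqV (0<V {x′ ∷ u′} (NoTrailingZero⇒LastNonzero z′)))
  tail-unique {u = x ∷ u} {[]} _ _ z _ eqV _ = ⊥-elim (<-irrefl (sym eqV) (0<V {x ∷ u} (NoTrailingZero⇒LastNonzero z)))
  tail-unique {u = x ∷ u} {x′ ∷ u′} (_ , _ , t) (_ , _ , t′) z z′ eqV eqH =
    cong₂ _∷_ x≡x′ (tail-unique t t′ (NoTrailingZero-tail z) (NoTrailingZero-tail z′) eqV-tail eqH-tail)
    where
    eqV-tail : V u ≡ V u′
    eqV-tail = +-cancelˡ (δ * V (x ∷ u))
      (trans (sym (H-cons x u)) (trans eqH (trans (H-cons x′ u′) (cong (λ v → δ * v + V u′) (sym eqV)))))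
    eqX : + x + H u ≡ + x′ + H u′
    eqX = trans (sym (V-cons x u)) (trans eqV (V-cons x′ u′))
    x≡x′ : x ≡ x′
    x≡x′ with x ℕ.≟ 0 | x′ ℕ.≟ 0
    ... | yes x≡0 | yes x′≡0 = trans x≡0 (sym x′≡0)
    ... | yes x≡0 | no x′≢0 = ⊥-elim (x′≢0 (ℕₚ.n≤0⇒n≡0 (subst (x′ ℕ.≤_) x≡0 (digit-≤ (OstTail⇒Digits t) x′≢0 t′ eqV-tail eqX))))
    ... | no x≢0 | yes x′≡0 = ⊥-elim (x≢0 (ℕₚ.n≤0⇒n≡0 (subst (x ℕ.≤_) x′≡0 (digit-≤ (OstTail⇒Digits t′) x≢0 t (sym eqV-tail) (sym eqX)))))
    ... | no x≢0 | no x′≢0 = ℕₚ.≤-antisym (digit-≤ (OstTail⇒Digits t′) x≢0 t (sym eqV-tail) (sym eqX))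
                                          (digit-≤ (OstTail⇒Digits t) x′≢0 t′ eqV-tail eqX)
    eqH-tail : H u ≡ H u′
    eqH-tail = +-cancelˡ (+ x) (trans eqX (cong (λ y → + y + H u′) (sym x≡x′)))

  OstWord-unique : ∀ {v v′} → OstWord v → OstWord v′ → LastNonzero v → LastNonzero v′ → val v ≡ val v′ → v ≡ v′
  OstWord-unique ov ov′ lnz lnz′ eq =
    tail-unique (OstWord⇒OstTail ov) (OstWord⇒OstTail ov′) (inj₂ lnz) (inj₂ lnz′) (cong +_ eq) (H-unique ov ov′ (cong +_ eq))

  -- Indices of trimmed words

  Trimmed⇒LastNonzero : ∀ {w} → Trimmed w → LastNonzero w
  Trimmed⇒LastNonzero = proj₁ ∘′ proj₂

  IsW-mono : ∀ {k k′ w w′} → IsW k w → IsW k′ w′ → val w ℕ.< val w′ → k ℕ.< k′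
  IsW-mono {w = w} {w′} (tw , L , uniqueL , refl , L⇔) (_ , L′ , _ , refl , L′⇔) w<w′ =
    s≤s (Unique-⊆⇒length-≤ (All.tabulate w∉L ∷ uniqueL) w∷L⊆L′)
    where
    w∉L : ∀ {z} → z ∈ L → w ≢ z
    w∉L z∈L refl = ℕₚ.<-irrefl refl (proj₂ (Equivalence.to (L⇔ w) z∈L))
    w∷L⊆L′ : ∀ {z} → z ∈ w ∷ L → z ∈ L′
    w∷L⊆L′ (here refl) = Equivalence.from (L′⇔ w) (tw , w<w′)
    w∷L⊆L′ {z} (there z∈L) with Equivalence.to (L⇔ z) z∈L
    ... | tz , z<w = Equivalence.from (L′⇔ z) (tz , ℕₚ.<-trans z<w w<w′)

  IsW-unique : ∀ {k w w′} → IsW k w → IsW k w′ → w ≡ w′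
  IsW-unique {w = w} {w′} iw iw′ with ℕₚ.<-cmp (val w) (val w′)
  ... | tri< w<w′ _ _ = ⊥-elim (ℕₚ.<-irrefl refl (IsW-mono iw iw′ w<w′))
  ... | tri> _ _ w′<w = ⊥-elim (ℕₚ.<-irrefl refl (IsW-mono iw′ iw w′<w))
  ... | tri≈ _ w≡w′ _ = OstWord-unique (proj₁ (proj₁ iw)) (proj₁ (proj₁ iw′))
                                       (Trimmed⇒LastNonzero (proj₁ iw)) (Trimmed⇒LastNonzero (proj₁ iw′)) w≡w′

  OstTail? : ∀ p u → Dec (OstTail p u)
  OstTail? p [] = yes tt
  OstTail? p (y ∷ u) = (y ℕ.≤? d) ×-dec (((y ℕ.≟ d) →-dec (p ℕ.≟ 0)) ×-dec OstTail? y u)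

  OstWord? : ∀ u → Dec (OstWord u)
  OstWord? [] = yes tt
  OstWord? (x ∷ u) = (x ℕ.<? d) ×-dec OstTail? x u

  LastNonzero? : ∀ u → Dec (LastNonzero u)
  LastNonzero? [] = no (λ ())
  LastNonzero? (x ∷ []) = ¬? (x ℕ.≟ 0)
  LastNonzero? (x ∷ y ∷ u) = LastNonzero? (y ∷ u)

  ZeroThenOstWord? : ∀ u → Dec (Σ Word λ v → OstWord v × (u ≡ 0 ∷ v))
  ZeroThenOstWord? [] = no (λ { (_ , _ , ()) })
  ZeroThenOstWord? (suc x ∷ v) = no (λ { (_ , _ , ()) })
  ZeroThenOstWord? (zero ∷ v) with OstWord? v
  ... | yes ov = yes (v , ov , refl)
  ... | no ¬ov = no (λ { (_ , ov , refl) → ¬ov ov })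

  Trimmed? : ∀ u → Dec (Trimmed u)
  Trimmed? u = OstWord? u ×-dec (LastNonzero? u ×-dec ¬? (ZeroThenOstWord? u))

  wordsUpTo : ℕ → List Word
  wordsUpTo zero = [] ∷ []
  wordsUpTo (suc n) = [] ∷ concatMap (λ x → map (x ∷_) (wordsUpTo n)) (upTo (suc d))

  ∈-wordsUpTo : ∀ n {u} → length u ℕ.≤ n → Digits u → u ∈ wordsUpTo n
  ∈-wordsUpTo zero {[]} _ _ = here refl
  ∈-wordsUpTo (suc n) {[]} _ _ = here refl
  ∈-wordsUpTo (suc n) {x ∷ u} (s≤s len≤n) (x≤d ∷ ds) =
    there (∈-concatMap⁺ (λ y → map (y ∷_) (wordsUpTo n)) (lose (∈-upTo⁺ (s≤s x≤d)) (∈-map⁺ (x ∷_) (∈-wordsUpTo n len≤n ds))))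

  D-length≤valFrom : ∀ k u → LastNonzero u → D (k ℕ.+ length u) ℕ.≤ valFrom (suc k) u
  D-length≤valFrom k (x ∷ []) x≢0 = begin
    D (k ℕ.+ 1)           ≡⟨ cong D (ℕₚ.+-comm k 1) ⟩
    D (suc k)             ≤⟨ ℕₚ.m≤n*m (D (suc k)) x {{ℕ.≢-nonZero x≢0}} ⟩
    x ℕ.* D (suc k)       ≤⟨ ℕₚ.m≤m+n _ 0 ⟩
    x ℕ.* D (suc k) ℕ.+ 0 ∎
    where open ℕₚ.≤-Reasoning
  D-length≤valFrom k (x ∷ y ∷ u) lnz = begin
    D (k ℕ.+ suc (length (y ∷ u)))        ≡⟨ cong D (ℕₚ.+-suc k _) ⟩
    D (suc k ℕ.+ length (y ∷ u))          ≤⟨ D-length≤valFrom (suc k) (y ∷ u) lnz ⟩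
    valFrom (suc (suc k)) (y ∷ u)         ≤⟨ ℕₚ.m≤n+m _ (x ℕ.* D (suc k)) ⟩
    valFrom (suc k) (x ∷ y ∷ u)           ∎
    where open ℕₚ.≤-Reasoning

  length≤val : ∀ {u} → LastNonzero u → length u ℕ.≤ val u
  length≤val {u} lnz = ℕₚ.≤-trans (n≤D (length u)) (D-length≤valFrom 0 u lnz)

  IsW-exists : ∀ {w} → Trimmed w → Σ ℕ λ k → IsW k w
  IsW-exists {w} tw = suc (length smaller) , tw , smaller , unique , refl , λ u → mk⇔ (proj₂ ∘′ ∈-filter⁻ P? {xs = candidates}) (complete u)
    where
    P : Word → Set
    P u = Trimmed u × val u ℕ.< val w
    P? : ∀ u → Dec (P u)
    P? u = Trimmed? u ×-dec (val u ℕ.<? val w)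
    candidates : List Word
    candidates = deduplicate (≡-dec ℕ._≟_) (wordsUpTo (val w))
    smaller : List Word
    smaller = filter P? candidates
    unique : Unique smaller
    unique = Unique.filter⁺ P? (UniqueDec.deduplicate-! (≡-dec ℕ._≟_) (wordsUpTo (val w)))
    complete : ∀ u → P u → u ∈ smaller
    complete u pu@((ou , lnz , _) , u<w) = ∈-filter⁺ P?
      (∈-deduplicate⁺ (≡-dec ℕ._≟_) (∈-wordsUpTo (val w) (ℕₚ.<⇒≤ (ℕₚ.≤-<-trans (length≤val {u} lnz) u<w)) (OstTail⇒Digits (OstWord⇒OstTail ou))))
      pu

  -- Existence of Ostrowski representations

  lastOr : ℕ → Word → ℕ
  lastOr p [] = p
  lastOr p (x ∷ v) = lastOr x v

  lastOr-snoc : ∀ p v a → lastOr p (v ++ a ∷ []) ≡ a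
  lastOr-snoc p [] a = refl
  lastOr-snoc p (x ∷ v) a = lastOr-snoc x v a

  valFrom-snoc : ∀ k v a → valFrom k (v ++ a ∷ []) ≡ valFrom k v ℕ.+ a ℕ.* D (k ℕ.+ length v)
  valFrom-snoc k [] a = trans (cong (λ i → a ℕ.* D i ℕ.+ 0) (sym (ℕₚ.+-identityʳ k))) (ℕₚ.+-identityʳ _)
  valFrom-snoc k (x ∷ v) a rewrite valFrom-snoc (suc k) v a | ℕₚ.+-suc k (length v) = sym (ℕₚ.+-assoc (x ℕ.* D k) _ _)

  OstTail-snoc : ∀ {p v a} → OstTail p v → a ℕ.≤ d → (a ≡ d → lastOr p v ≡ 0) → OstTail p (v ++ a ∷ [])
  OstTail-snoc {v = []} _ a≤d a≡d⇒0 = a≤d , a≡d⇒0 , tt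
  OstTail-snoc {v = x ∷ v} (x≤d , c , t) a≤d a≡d⇒0 = x≤d , c , OstTail-snoc t a≤d a≡d⇒0

  LastNonzero-snoc : ∀ v {a} → a ≢ 0 → LastNonzero (v ++ a ∷ [])
  LastNonzero-snoc [] a≢0 = a≢0
  LastNonzero-snoc (x ∷ []) a≢0 = a≢0
  LastNonzero-snoc (x ∷ y ∷ v) a≢0 = LastNonzero-snoc (y ∷ v) a≢0

  D-mono : ∀ n → D n ℕ.≤ D (suc n)
  D-mono zero = z≤n
  D-mono (suc n) = ℕₚ.≤-trans (ℕₚ.m≤n*m (D (suc n)) d {{ℕ.>-nonZero 0<d}}) (ℕₚ.m≤m+n _ _)

  -- An Ostrowski word of length n for every X < D (n+1), built by peeling off the
  -- top digit X / Dₙ₊₁ ≤ d; if that digit equals d the remainder is below Dₙ.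
  record Representation (n X : ℕ) : Set where
    field
      word : Word
      length-word : length word ≡ n
      ostrowski : OstWord word
      value : val word ≡ X
      top-zero : X ℕ.< D n → lastOr 0 word ≡ 0

  representation : ∀ n X → X ℕ.< D (suc n) → Representation n X
  representation zero X X<1 = record
    { word = [] ; length-word = refl ; ostrowski = tt ; value = sym (ℕₚ.n<1⇒n≡0 X<1) ; top-zero = λ _ → refl }
  representation (suc n) X X<D = record
    { word = v ++ a ∷ []
    ; length-word = trans (length-++ v) (trans (ℕₚ.+-comm (length v) 1) (cong suc length-v))
    ; ostrowski = snoc-ostrowski v length-v ost-v top-zero-v
    ; value = trans (valFrom-snoc 1 v a) (trans (cong₂ (λ u i → u ℕ.+ a ℕ.* D (suc i)) value-v length-v) (sym X≡))
    ; top-zero = λ X<Dn+1 → trans (lastOr-snoc 0 v a) (m<n⇒m/n≡0 X<Dn+1)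
    }
    where
    instance _ = ℕ.>-nonZero (0<D n)
    a X′ : ℕ
    a = X ℕ./ D (suc n)
    X′ = X ℕ.% D (suc n)
    open Representation (representation n X′ (m%n<n X (D (suc n))))
      renaming (word to v; length-word to length-v; ostrowski to ost-v; value to value-v; top-zero to top-zero-v)
    X≡ : X ≡ X′ ℕ.+ a ℕ.* D (suc n)
    X≡ = m≡m%n+[m/n]*n X (D (suc n))
    a≤d : a ℕ.≤ d
    a≤d = ℕₚ.≤-pred (m<n*o⇒m/o<n (ℕₚ.<-≤-trans X<D
            (subst (d ℕ.* D (suc n) ℕ.+ D n ℕ.≤_) (ℕₚ.+-comm (d ℕ.* D (suc n)) (D (suc n))) (ℕₚ.+-monoʳ-≤ (d ℕ.* D (suc n)) (D-mono n)))))
    a≡d⇒X′<D : a ≡ d → X′ ℕ.< D n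
    a≡d⇒X′<D a≡d = ℕₚ.+-cancelʳ-< (d ℕ.* D (suc n)) X′ (D n)
      (subst₂ ℕ._<_ (trans X≡ (cong (λ z → X′ ℕ.+ z ℕ.* D (suc n)) a≡d)) (ℕₚ.+-comm (d ℕ.* D (suc n)) (D n)) X<D)
    snoc-ostrowski : ∀ w → length w ≡ n → OstWord w → (X′ ℕ.< D n → lastOr 0 w ≡ 0) → OstWord (w ++ a ∷ [])
    snoc-ostrowski [] refl _ _ = m<n*o⇒m/o<n {X} {d} (subst (X ℕ.<_) (ℕₚ.+-identityʳ (d ℕ.* 1)) X<D) , tt
    snoc-ostrowski (x ∷ w) _ (x<d , t) top-zero-w = x<d , OstTail-snoc t a≤d (λ a≡d → top-zero-w (a≡d⇒X′<D a≡d))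

  consNonzero : ℕ → Word → Word
  consNonzero x (y ∷ w) = x ∷ y ∷ w
  consNonzero zero [] = []
  consNonzero (suc x) [] = suc x ∷ []

  dropTrailingZeros : Word → Word
  dropTrailingZeros [] = []
  dropTrailingZeros (x ∷ u) = consNonzero x (dropTrailingZeros u)

  valFrom-consNonzero : ∀ k x w → valFrom k (consNonzero x w) ≡ x ℕ.* D k ℕ.+ valFrom (suc k) w
  valFrom-consNonzero k zero [] = refl
  valFrom-consNonzero k (suc x) [] = refl
  valFrom-consNonzero k x (y ∷ w) = refl

  valFrom-dropTrailingZeros : ∀ k u → valFrom k (dropTrailingZeros u) ≡ valFrom k u
  valFrom-dropTrailingZeros k [] = refl
  valFrom-dropTrailingZeros k (x ∷ u) =
    trans (valFrom-consNonzero k x (dropTrailingZeros u)) (cong (x ℕ.* D k ℕ.+_) (valFrom-dropTrailingZeros (suc k) u))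

  OstTail-consNonzero : ∀ {p x w} → OstTail p (x ∷ w) → OstTail p (consNonzero x w)
  OstTail-consNonzero {x = zero} {[]} _ = tt
  OstTail-consNonzero {x = suc x} {[]} t = t
  OstTail-consNonzero {w = y ∷ w} t = t

  OstTail-dropTrailingZeros : ∀ {p u} → OstTail p u → OstTail p (dropTrailingZeros u)
  OstTail-dropTrailingZeros {u = []} _ = tt
  OstTail-dropTrailingZeros {u = x ∷ u} (x≤d , c , t) = OstTail-consNonzero (x≤d , c , OstTail-dropTrailingZeros t)

  OstWord-dropTrailingZeros : ∀ {u} → OstWord u → OstWord (dropTrailingZeros u)
  OstWord-dropTrailingZeros {[]} _ = tt
  OstWord-dropTrailingZeros {x ∷ u} (x<d , t) = first-digit x<d (OstTail-dropTrailingZeros t)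
    where
    first-digit : ∀ {x w} → x ℕ.< d → OstTail x w → OstWord (consNonzero x w)
    first-digit {w = y ∷ w} x<d t = x<d , t
    first-digit {zero} {[]} _ _ = tt
    first-digit {suc x} {[]} x<d _ = x<d , tt

  NoTrailingZero-dropTrailingZeros : ∀ u → NoTrailingZero (dropTrailingZeros u)
  NoTrailingZero-dropTrailingZeros [] = inj₁ refl
  NoTrailingZero-dropTrailingZeros (x ∷ u) = cons x (NoTrailingZero-dropTrailingZeros u)
    where
    cons : ∀ x {w} → NoTrailingZero w → NoTrailingZero (consNonzero x w)
    cons zero {[]} _ = inj₁ refl
    cons (suc x) {[]} _ = inj₂ (λ ())
    cons x {y ∷ w} (inj₂ lnz) = inj₂ lnz

  ostrowski-representation : ∀ N → 0 ℕ.< N → Σ Word λ v → OstWord v × LastNonzero v × val v ≡ N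
  ostrowski-representation N 0<N =
    v , OstWord-dropTrailingZeros ostrowski , lastNonzero (NoTrailingZero-dropTrailingZeros word) , val-v
    where
    open Representation (representation N N (ℕₚ.<-≤-trans (ℕₚ.n<1+n N) (n≤D (suc N))))
    v = dropTrailingZeros word
    val-v : val v ≡ N
    val-v = trans (valFrom-dropTrailingZeros 1 word) value
    lastNonzero : NoTrailingZero v → LastNonzero v
    lastNonzero (inj₂ lnz) = lnz
    lastNonzero (inj₁ v≡[]) = ⊥-elim (ℕₚ.<⇒≢ 0<N (trans (sym (cong val v≡[])) val-v))

  -- Negative rows

  α^_·_ : ℕ → Elt → Elt
  α^ zero · x = x
  α^ suc n · x = α· (α^ n · x)

  α^-α· : ∀ n x → α^ n · (α· x) ≡ α· (α^ n · x)
  α^-α· zero x = refl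
  α^-α· (suc n) x = cong α·_ (α^-α· n x)

  α·-distrib-+ᴱ : ∀ x y → α· (x +ᴱ y) ≡ α· x +ᴱ α· y
  α·-distrib-+ᴱ (a , b) (a′ , b′) = cong (b + b′ ,_) (regroup a b a′ b′ δ)
    where
    regroup : ∀ a b a′ b′ δ → (a + a′) + δ * (b + b′) ≡ (a + δ * b) + (a′ + δ * b′)
    regroup = solve-∀

  α·-distrib-−ᴱ : ∀ x y → α· (x -ᴱ y) ≡ α· x -ᴱ α· y
  α·-distrib-−ᴱ (a , b) (a′ , b′) = cong (b - b′ ,_) (regroup a b a′ b′ δ)
    where
    regroup : ∀ a b a′ b′ δ → (a - a′) + δ * (b - b′) ≡ (a + δ * b) - (a′ + δ * b′)
    regroup = solve-∀

  α^-distrib-+ᴱ : ∀ n x y → α^ n · (x +ᴱ y) ≡ α^ n · x +ᴱ α^ n · y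
  α^-distrib-+ᴱ zero x y = refl
  α^-distrib-+ᴱ (suc n) x y = trans (cong α·_ (α^-distrib-+ᴱ n x y)) (α·-distrib-+ᴱ (α^ n · x) (α^ n · y))

  α^-distrib-−ᴱ : ∀ n x y → α^ n · (x -ᴱ y) ≡ α^ n · x -ᴱ α^ n · y
  α^-distrib-−ᴱ zero x y = refl
  α^-distrib-−ᴱ (suc n) x y = trans (cong α·_ (α^-distrib-−ᴱ n x y)) (α·-distrib-−ᴱ (α^ n · x) (α^ n · y))

  α·-injective : ∀ {x y} → α· x ≡ α· y → x ≡ y
  α·-injective {a , b} {a′ , b′} eq = cong₂ _,_ (+-cancelˡ (δ * b) a-part) b≡b′
    where
    b≡b′ : b ≡ b′
    b≡b′ = cong proj₁ eq
    a-part : δ * b + a ≡ δ * b + a′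
    a-part = trans (+-comm (δ * b) a) (trans (cong proj₂ eq) (trans (cong (λ z → a′ + δ * z) (sym b≡b′)) (+-comm a′ (δ * b))))

  α^-injective : ∀ n {x y} → α^ n · x ≡ α^ n · y → x ≡ y
  α^-injective zero eq = eq
  α^-injective (suc n) eq = α^-injective n (α·-injective eq)

  NonNeg-α^⁻ : ∀ n {x} → NonNeg (α^ n · x) → NonNeg x
  NonNeg-α^⁻ zero nx = nx
  NonNeg-α^⁻ (suc n) nx = NonNeg-α^⁻ n (NonNeg-α⁻ nx)

  α·α⁻¹ : α· invα ≡ 1ᴱ
  α·α⁻¹ = cong (1ℤ ,_) (cancel δ)
    where
    cancel : ∀ δ → - δ + δ * 1ℤ ≡ 0ℤ
    cancel = solve-∀

  α^-α⁻¹ : ∀ n → α^ suc n · invα ≡ α^ n · 1ᴱ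
  α^-α⁻¹ n = trans (sym (α^-α· n invα)) (cong (α^ n ·_) α·α⁻¹)

  -- R w = Σ wⱼ α^{j+1} = A₁ + A₂ α, where A is the row of w.
  R : Word → Elt
  R w = V w , H w

  R-cons : ∀ x u → R (x ∷ u) ≡ α· (α· ofℤ (+ x) +ᴱ R u)
  R-cons x u = cong₂ _,_ (trans (V-cons x u) (first (+ x) (H u) δ))
                         (trans (H-cons x u) (trans (cong (λ v → δ * v + V u) (V-cons x u)) (second (+ x) (H u) (V u) δ)))
    where
    first : ∀ x h δ → x + h ≡ (x + δ * 0ℤ) + h
    first = solve-∀
    second : ∀ x h v δ → δ * (x + h) + v ≡ (0ℤ + v) + δ * ((x + δ * 0ℤ) + h)
    second = solve-∀

  back-α : ∀ w j → α· back w (suc j) ≡ back w j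
  back-α w j = cong (proj₁ (back w j) ,_) (cancel (proj₁ (back w j)) (proj₂ (back w j)) δ)
    where
    cancel : ∀ p q δ → (q - δ * p) + δ * p ≡ q
    cancel = solve-∀

  α^-back : ∀ w j → α^ j · back w j ≡ R w
  α^-back w zero = refl
  α^-back w (suc j) = trans (sym (α^-α· j (back w (suc j)))) (trans (cong (α^ j ·_) (back-α w j)) (α^-back w j))

  -- ρ w = A_{k,-|w|-1} + A_{k,-|w|} α, so that ρ w = α^{-|w|-2} R w.
  ρ : Word → Elt
  ρ w = back w (suc (suc (length w)))

  α^-ρ : ∀ w → α^ (suc (suc (length w))) · ρ w ≡ R w
  α^-ρ w = α^-back w (suc (suc (length w)))

  negRow-back : ∀ w {l} → length w ≡ suc l → ∀ m → negRow w (suc m) ≡ proj₁ (back w (suc (suc (l ℕ.+ m))))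
  negRow-back w {l} len m = cong (row w) (begin
    (1ℤ - + length w) - + suc m   ≡⟨ cong (λ n → (1ℤ - + n) - + suc m) len ⟩
    (1ℤ - (1ℤ + + l)) - (1ℤ + + m) ≡⟨ index (+ l) (+ m) ⟩
    - (1ℤ + (+ l + + m))           ≡⟨ cong (λ i → - (1ℤ + i)) (sym (pos-+ l m)) ⟩
    -[1+ l ℕ.+ m ]                 ∎)
    where
    open ≡-Reasoning
    index : ∀ l m → (1ℤ - (1ℤ + l)) - (1ℤ + m) ≡ - (1ℤ + (l + m))
    index = solve-∀

  ρ-negRow : ∀ w {l} → length w ≡ suc l → ρ w ≡ (negRow w 2 , negRow w 1)
  ρ-negRow w {l} len = sym (cong₂ _,_
    (trans (negRow-back w len 1) (cong (λ i → proj₁ (back w (suc (suc i)))) (trans (ℕₚ.+-comm l 1) (sym len))))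
    (trans (negRow-back w len 0) (cong (λ i → proj₁ (back w (suc i))) (trans (cong suc (ℕₚ.+-identityʳ l)) (sym len)))))

  negRow-rec : ∀ w {l} → length w ≡ suc l → ∀ m →
               negRow w (suc (suc (suc m))) ≡ negRow w (suc m) - δ * negRow w (suc (suc m))
  negRow-rec w {l} len m = begin
    negRow w (3 ℕ.+ m)                                ≡⟨ negRow-back w len (2 ℕ.+ m) ⟩
    proj₁ (back w (2 ℕ.+ (l ℕ.+ (2 ℕ.+ m))))          ≡⟨ cong (λ i → proj₁ (back w (2 ℕ.+ i))) (ℕₚ.+-suc l (suc m)) ⟩
    proj₁ (back w (3 ℕ.+ (l ℕ.+ (1 ℕ.+ m))))          ≡⟨ cong (λ i → proj₁ (back w (3 ℕ.+ i))) (ℕₚ.+-suc l m) ⟩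
    proj₁ (back w (4 ℕ.+ (l ℕ.+ m)))                  ≡⟨ cong₂ (λ u v → u - δ * v) (sym (negRow-back w len m))
                                                            (sym (trans (negRow-back w len (suc m)) (cong (λ i → proj₁ (back w (2 ℕ.+ i))) (ℕₚ.+-suc l m)))) ⟩
    negRow w (1 ℕ.+ m) - δ * negRow w (2 ℕ.+ m)       ∎
    where open ≡-Reasoning

  α^|w|+1≤R : ∀ {w} → LastNonzero w → α^ (suc (length w)) · 1ᴱ ≤ₛ R w
  α^|w|+1≤R {x ∷ []} x≢0 = subst NonNeg (sym shape) (NonNeg-α (NonNeg-α (NonNeg-ofℤ (i≤j⇒0≤j-i (+≤+ (ℕₚ.n≢0⇒n>0 x≢0))))))
    where
    shape : R (x ∷ []) -ᴱ α^ 2 · 1ᴱ ≡ α· (α· ofℤ (+ x - 1ℤ))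
    shape = trans (cong (_-ᴱ α^ 2 · 1ᴱ) (R-cons x [])) (trans (sym (α·-distrib-−ᴱ (α· ofℤ (+ x) +ᴱ R []) (α· 1ᴱ)))
              (cong α·_ (cong (0ℤ ,_) (simplify (+ x) δ))))
      where
      simplify : ∀ x δ → ((x + δ * 0ℤ) + 0ℤ) - (1ℤ + δ * 0ℤ) ≡ (x - 1ℤ) + δ * 0ℤ
      simplify = solve-∀
  α^|w|+1≤R {x ∷ u@(_ ∷ _)} lnz = subst NonNeg (sym shape)
    (NonNeg-α (NonNeg-+ (NonNeg-α (NonNeg-ofℤ (+≤+ z≤n))) (α^|w|+1≤R {u} lnz)))
    where
    shape : R (x ∷ u) -ᴱ α^ (suc (length (x ∷ u))) · 1ᴱ ≡ α· (α· ofℤ (+ x) +ᴱ (R u -ᴱ α^ (suc (length u)) · 1ᴱ))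
    shape = trans (cong (_-ᴱ α^ (suc (length (x ∷ u))) · 1ᴱ) (R-cons x u))
              (trans (sym (α·-distrib-−ᴱ (α· ofℤ (+ x) +ᴱ R u) (α^ (suc (length u)) · 1ᴱ))) (cong α·_ (regroup (α· ofℤ (+ x)) (R u) (α^ (suc (length u)) · 1ᴱ))))
      where
      regroup : ∀ a b c → (a +ᴱ b) -ᴱ c ≡ a +ᴱ (b -ᴱ c)
      regroup (a , a′) (b , b′) (c , c′) = cong₂ _,_ (assoc a b c) (assoc a′ b′ c′)
        where
        assoc : ∀ a b c → (a + b) - c ≡ a + (b - c)
        assoc = solve-∀

  α⁻¹≤ρ : ∀ {w} → LastNonzero w → invα ≤ₛ ρ w
  α⁻¹≤ρ {w} lnz = NonNeg-α^⁻ (suc (suc (length w))) (subst NonNeg shape (α^|w|+1≤R {w} lnz))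
    where
    shape : R w -ᴱ α^ (suc (length w)) · 1ᴱ ≡ α^ (suc (suc (length w))) · (ρ w -ᴱ invα)
    shape = sym (trans (α^-distrib-−ᴱ (suc (suc (length w))) (ρ w) invα) (cong₂ _-ᴱ_ (α^-ρ w) (α^-α⁻¹ (suc (length w)))))

  -- Coincidence of the red and left walls

  nonempty : ∀ {w} → LastNonzero w → Σ ℕ λ l → length w ≡ suc l
  nonempty {x ∷ u} _ = length u , refl

  H-shift : ∀ w → + valFrom 3 w ≡ δ * H w + V w
  H-shift w = trans (cong +_ (valFrom-linear 1 w)) (trans (pos-+ (d ℕ.* valFrom 2 w) (valFrom 1 w)) (cong (_+ V w) (pos-* d (valFrom 2 w))))

  -- In each excluded sign pattern the third entry forces 2V = 0 or 2δH = 0.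
  opposite-signs : ∀ {a b v h} → 0ℤ < v → 0ℤ < h →
                   (a ≡ v ⊎ a ≡ - v) → (b ≡ h ⊎ b ≡ - h) → (a - δ * b ≡ δ * h + v ⊎ a - δ * b ≡ - (δ * h + v)) →
                   (a ≡ v × b ≡ - h) ⊎ (a ≡ - v × b ≡ h)
  opposite-signs _ _ (inj₁ a≡v) (inj₂ b≡-h) _ = inj₁ (a≡v , b≡-h)
  opposite-signs _ _ (inj₂ a≡-v) (inj₁ b≡h) _ = inj₂ (a≡-v , b≡h)
  opposite-signs {a} {b} {v} {h} 0<v 0<h (inj₁ refl) (inj₁ refl) (inj₁ eq) = ⊥-elim (i+i≢0 (0<i*j 0<δ 0<h) (trans (e₁ v h δ) (i≡j⇒i-j≡0 (sym eq))))
    where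
    e₁ : ∀ v h δ → δ * h + δ * h ≡ (δ * h + v) - (v - δ * h)
    e₁ = solve-∀
  opposite-signs {a} {b} {v} {h} 0<v 0<h (inj₁ refl) (inj₁ refl) (inj₂ eq) = ⊥-elim (i+i≢0 0<v (trans (e₂ v h δ) (i≡j⇒i-j≡0 eq)))
    where
    e₂ : ∀ v h δ → v + v ≡ (v - δ * h) - - (δ * h + v)
    e₂ = solve-∀
  opposite-signs {a} {b} {v} {h} 0<v 0<h (inj₂ refl) (inj₂ refl) (inj₁ eq) = ⊥-elim (i+i≢0 0<v (trans (e₃ v h δ) (i≡j⇒i-j≡0 (sym eq))))
    where
    e₃ : ∀ v h δ → v + v ≡ (δ * h + v) - (- v - δ * - h)
    e₃ = solve-∀
  opposite-signs {a} {b} {v} {h} 0<v 0<h (inj₂ refl) (inj₂ refl) (inj₂ eq) = ⊥-elim (i+i≢0 (0<i*j 0<δ 0<h) (trans (e₄ v h δ) (i≡j⇒i-j≡0 eq)))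
    where
    e₄ : ∀ v h δ → δ * h + δ * h ≡ (- v - δ * - h) - - (δ * h + v)
    e₄ = solve-∀

  Coincidence : Word → Word → Set
  Coincidence wk wm = (n : ℕ) → 1 ℕ.≤ n → + ∣ negRow wk n ∣ ≡ row wm (+ n)

  coincidence⇒ρ≡F : ∀ {wk wm} → LastNonzero wk → OstWord wm → LastNonzero wm → Coincidence wk wm → ρ wk ≡ F wm
  coincidence⇒ρ≡F {wk} {wm} lnzk ow lnzm coincide = conclude signs
    where
    len : length wk ≡ suc (proj₁ (nonempty {wk} lnzk))
    len = proj₂ (nonempty {wk} lnzk)
    third : + ∣ negRow wk 1 - δ * negRow wk 2 ∣ ≡ δ * H wm + V wm
    third = trans (cong (λ z → + ∣ z ∣) (sym (negRow-rec wk len 0))) (trans (coincide 3 (s≤s z≤n)) (H-shift wm))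
    signs : (negRow wk 1 ≡ V wm × negRow wk 2 ≡ - H wm) ⊎ (negRow wk 1 ≡ - V wm × negRow wk 2 ≡ H wm)
    signs = opposite-signs {negRow wk 1} {negRow wk 2} {V wm} {H wm} (0<V {wm} lnzm) (0<H {wm} lnzm)
              (+∣i∣≡j⇒i≡±j (coincide 1 (s≤s z≤n))) (+∣i∣≡j⇒i≡±j (coincide 2 (s≤s z≤n))) (+∣i∣≡j⇒i≡±j third)
    conclude : (negRow wk 1 ≡ V wm × negRow wk 2 ≡ - H wm) ⊎ (negRow wk 1 ≡ - V wm × negRow wk 2 ≡ H wm) → ρ wk ≡ F wm
    conclude (inj₁ (first , second)) = trans (ρ-negRow wk len) (cong₂ _,_ second first)
    conclude (inj₂ (first , second)) = ⊥-elim (<-irrefl refl (Pos-ofℤ⁻ (subst Pos cancel (NonNeg-+-Pos (α⁻¹≤ρ {wk} lnzk) (proj₁ (F-window ow))))))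
      where
      c₁ : ∀ h δ → (h - - δ) + (- h - - - δ) ≡ 0ℤ
      c₁ = solve-∀
      c₂ : ∀ v → (- v - 1ℤ) + (v - - 1ℤ) ≡ 0ℤ
      c₂ = solve-∀
      cancel : (ρ wk -ᴱ invα) +ᴱ (F wm -ᴱ negᴱ invα) ≡ ofℤ 0ℤ
      cancel = trans (cong (λ r → (r -ᴱ invα) +ᴱ (F wm -ᴱ negᴱ invα)) (trans (ρ-negRow wk len) (cong₂ _,_ second first)))
                     (cong₂ _,_ (c₁ (H wm) δ) (c₂ (V wm)))

  A : Word → ℕ → ℤ
  A v m = + valFrom (suc m) v

  valFrom-zeros : ∀ k j w → valFrom j (replicate k 0 ++ w) ≡ valFrom (k ℕ.+ j) w
  valFrom-zeros zero j w = refl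
  valFrom-zeros (suc k) j w = trans (valFrom-zeros k (suc j) w) (cong (λ i → valFrom i w) (ℕₚ.+-suc k j))

  row≡A : ∀ v m → row v (+ suc m) ≡ A v m
  row≡A v m = cong +_ (trans (valFrom-zeros m 1 v) (cong (λ i → valFrom i v) (ℕₚ.+-comm m 1)))

  A-linear : ∀ v m → A v (suc (suc m)) ≡ δ * A v (suc m) + A v m
  A-linear v m = trans (cong +_ (valFrom-linear (suc m) v))
                       (trans (pos-+ (d ℕ.* valFrom (suc (suc m)) v) _) (cong (_+ A v m) (pos-* d (valFrom (suc (suc m)) v))))

  Alternating : Word → Word → ℕ → Set
  Alternating wk v m = (negRow wk (suc m) ≡ A v m × negRow wk (suc (suc m)) ≡ - A v (suc m))
                     ⊎ (negRow wk (suc m) ≡ - A v m × negRow wk (suc (suc m)) ≡ A v (suc m))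

  alternating : ∀ {wk v l} → length wk ≡ suc l → Alternating wk v 0 → ∀ m → Alternating wk v m
  alternating len start zero = start
  alternating {wk} {v} len start (suc m) with alternating {wk} {v} len start m
  ... | inj₁ (p , q) = inj₂ (q , trans (negRow-rec wk len m) (trans (cong₂ (λ x y → x - δ * y) p q)
                                  (trans (e₁ (A v m) (A v (suc m)) δ) (sym (A-linear v m)))))
    where
    e₁ : ∀ p q δ → p - δ * - q ≡ δ * q + p
    e₁ = solve-∀
  ... | inj₂ (p , q) = inj₁ (q , trans (negRow-rec wk len m) (trans (cong₂ (λ x y → x - δ * y) p q)
                                  (trans (e₂ (A v m) (A v (suc m)) δ) (cong -_ (sym (A-linear v m))))))
    where
    e₂ : ∀ p q δ → - p - δ * q ≡ - (δ * q + p)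
    e₂ = solve-∀

  ρ≡F⇒coincidence : ∀ {wk v l} → length wk ≡ suc l → ρ wk ≡ F v → Coincidence wk v
  ρ≡F⇒coincidence {wk} {v} len ρ≡F (suc m) _ = trans (absolute (alternating {wk} {v} len start m)) (sym (row≡A v m))
    where
    start : Alternating wk v 0
    start = inj₁ (cong proj₂ (trans (sym (ρ-negRow wk len)) ρ≡F) , cong proj₁ (trans (sym (ρ-negRow wk len)) ρ≡F))
    absolute : Alternating wk v m → + ∣ negRow wk (suc m) ∣ ≡ A v m
    absolute (inj₁ (p , _)) = cong (λ z → + ∣ z ∣) p
    absolute (inj₂ (p , _)) = trans (cong (λ z → + ∣ z ∣) p) (cong +_ (∣-i∣≡∣i∣ (A v m)))

  -- The fractional-part window

  ≤ₛ∧≢⇒<ₛ : ∀ {x y} → x ≤ₛ y → x ≢ y → x <ₛ y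
  ≤ₛ∧≢⇒<ₛ {x@(a , b)} {y@(a′ , b′)} x≤y x≢y with trichotomy (y -ᴱ x)
  ... | inj₁ pos = pos
  ... | inj₂ (inj₁ y-x≡0) = ⊥-elim (x≢y (sym (cong₂ _,_ (i-j≡0⇒i≡j a′ a (cong proj₁ y-x≡0)) (i-j≡0⇒i≡j b′ b (cong proj₂ y-x≡0)))))
  ... | inj₂ (inj₂ neg) = ⊥-elim (NonNeg⇒¬Pos-neg x≤y neg)

  -- The right end point of the window in FracCond is never attained: 1 - α⁻¹ has α-part -1.
  FracWindow : ℕ → ℤ → Set
  FracWindow N q = invα ≤ₛ (- q , + N) × (- q , + N) <ₛ (1ᴱ -ᴱ invα)

  αN-q : ∀ N q → αN N -ᴱ ofℤ q ≡ (- q , + N)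
  αN-q N q = cong₂ _,_ (+-identityˡ (- q)) (+-identityʳ (+ N))

  FracCond⇒FracWindow : ∀ N → FracCond N → Σ ℤ (FracWindow N)
  FracCond⇒FracWindow N (q , _ , lower , upper) = q ,
    subst (λ φ → invα ≤ₛ φ) (αN-q N q) (NonNegᴱ⇒NonNeg _ lower) ,
    ≤ₛ∧≢⇒<ₛ { - q , + N} {1ᴱ -ᴱ invα} (subst (λ φ → φ ≤ₛ (1ᴱ -ᴱ invα)) (αN-q N q) (NonNegᴱ⇒NonNeg _ upper)) (λ eq → +≢-1 (cong proj₂ eq))
    where
    +≢-1 : + N ≢ 0ℤ - 1ℤ
    +≢-1 ()

  FracWindow⇒FracCond : ∀ N q → FracWindow N q → FracCond N
  FracWindow⇒FracCond N q (lower , upper) = q , (floor-lower , floor-upper) ,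
    NonNeg⇒NonNegᴱ _ (subst (λ φ → invα ≤ₛ φ) (sym (αN-q N q)) lower) ,
    NonNeg⇒NonNegᴱ _ (Pos⇒NonNeg (subst (λ φ → φ <ₛ (1ᴱ -ᴱ invα)) (sym (αN-q N q)) upper))
    where
    floor-lower : ofℤ q ≤ᴱ αN N
    floor-lower = NonNeg⇒NonNegᴱ _ (Pos⇒NonNeg (subst Pos (cong₂ _,_ (e₁ q δ) (e₂ (+ N))) (NonNeg-+-Pos lower 0<α⁻¹)))
      where
      e₁ : ∀ q δ → (- q - - δ) + - δ ≡ 0ℤ - q
      e₁ = solve-∀
      e₂ : ∀ n → (n - 1ℤ) + 1ℤ ≡ n - 0ℤ
      e₂ = solve-∀
    floor-upper : αN N <ᴱ ofℤ (q + + 1)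
    floor-upper = Pos⇒Posᴱ _ (subst Pos (cong₂ _,_ (e₁ q δ) (e₂ (+ N))) (Pos-+ upper 0<α⁻¹))
      where
      e₁ : ∀ q δ → ((1ℤ - - δ) - - q) + - δ ≡ (q + 1ℤ) - 0ℤ
      e₁ = solve-∀
      e₂ : ∀ n → ((0ℤ - 1ℤ) - n) + 1ℤ ≡ 0ℤ - n
      e₂ = solve-∀

  α⁻¹≤φ⇒1≤αφ : ∀ {φ} → invα ≤ₛ φ → 1ᴱ ≤ₛ α· φ
  α⁻¹≤φ⇒1≤αφ {φ} α⁻¹≤φ = subst NonNeg (trans (α·-distrib-−ᴱ φ invα) (cong (α· φ -ᴱ_) α·α⁻¹)) (NonNeg-α α⁻¹≤φ)

  α·F-0∷ : ∀ u → α· F (0 ∷ u) ≡ negᴱ (F u)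
  α·F-0∷ u = trans (cong α·_ (F-cons 0 u)) (cong₂ _,_ (e₁ (H u)) (e₂ (H u) (V u) δ))
    where
    e₁ : ∀ h → 0ℤ + h ≡ - - h
    e₁ = solve-∀
    e₂ : ∀ h v δ → - (δ * (0ℤ + h) + v) + δ * (0ℤ + h) ≡ - v
    e₂ = solve-∀

  -- A word whose F is at least α⁻¹ cannot start with 0: otherwise α F = -F (tail) < α⁻¹ < 1.
  α⁻¹≤F⇒¬0∷ : ∀ {v} → invα ≤ₛ F v → ¬ (Σ Word λ u → OstWord u × (v ≡ 0 ∷ u))
  α⁻¹≤F⇒¬0∷ {v} α⁻¹≤Fv (u , ou , refl) =
    NonNeg⇒¬Pos-neg (Pos⇒NonNeg α⁻¹<1) (subst Pos cancel (NonNeg-+-Pos (α⁻¹≤φ⇒1≤αφ {F (0 ∷ u)} α⁻¹≤Fv) (proj₁ (F-window ou))))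
    where
    e₁ : ∀ f δ → (- f - 1ℤ) + (f - - - δ) ≡ - (1ℤ - - δ)
    e₁ = solve-∀
    e₂ : ∀ f → (- f - 0ℤ) + (f - - 1ℤ) ≡ - (0ℤ - 1ℤ)
    e₂ = solve-∀
    cancel : (α· F (0 ∷ u) -ᴱ 1ᴱ) +ᴱ (F u -ᴱ negᴱ invα) ≡ negᴱ (1ᴱ -ᴱ invα)
    cancel = trans (cong (λ y → (y -ᴱ 1ᴱ) +ᴱ (F u -ᴱ negᴱ invα)) (α·F-0∷ u)) (cong₂ _,_ (e₁ (proj₁ (F u)) δ) (e₂ (proj₂ (F u))))

  -- Greedy α-expansions

  negᴱ-diff : ∀ x y → negᴱ (y -ᴱ x) ≡ x -ᴱ y
  negᴱ-diff (a , b) (a′ , b′) = cong₂ _,_ (negate a a′) (negate b b′)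
    where
    negate : ∀ u u′ → - (u′ - u) ≡ u - u′
    negate = solve-∀

  <ₛ⊎≥ₛ : ∀ x y → x <ₛ y ⊎ y ≤ₛ x
  <ₛ⊎≥ₛ x y with trichotomy (y -ᴱ x)
  ... | inj₁ pos = inj₁ pos
  ... | inj₂ (inj₁ y-x≡0) = inj₂ (subst NonNeg (trans (cong negᴱ (sym y-x≡0)) (negᴱ-diff x y)) (NonNeg-ofℤ ≤-refl))
  ... | inj₂ (inj₂ neg) = inj₂ (Pos⇒NonNeg (subst Pos (negᴱ-diff x y) neg))

  Digit : Elt → Set
  Digit y = Σ[ r ∈ ℕ ] r ℕ.≤ d × ofℤ (+ r) ≤ₛ y × y <ₛ ofℤ (+ suc r)

  find-digit : ∀ y k f → k ℕ.+ f ≡ d → ofℤ (+ k) ≤ₛ y → y <ₛ ofℤ (+ suc d) → Digit y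
  find-digit y k zero k+0≡d k≤y y<d+1 = k , ℕₚ.≤-reflexive k≡d , k≤y , subst (λ i → y <ₛ ofℤ (+ suc i)) (sym k≡d) y<d+1
    where
    k≡d : k ≡ d
    k≡d = trans (sym (ℕₚ.+-identityʳ k)) k+0≡d
  find-digit y k (suc f) k+f≡d k≤y y<d+1 with <ₛ⊎≥ₛ y (ofℤ (+ suc k))
  ... | inj₁ y<k+1 = k , ℕₚ.≤-trans (ℕₚ.m≤m+n k (suc f)) (ℕₚ.≤-reflexive k+f≡d) , k≤y , y<k+1
  ... | inj₂ k+1≤y = find-digit y (suc k) f (trans (sym (ℕₚ.+-suc k f)) k+f≡d) k+1≤y y<d+1

  infix 25 _·ᴱ_

  _·ᴱ_ : ℤ → Elt → Elt
  c ·ᴱ (a , b) = c * a , c * b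

  Pos-·ᴱ : ∀ {c x} → 0ℤ < c → Pos x → Pos (c ·ᴱ x)
  Pos-·ᴱ {c} {x@(a , b)} 0<c (mkPos (n , p , q)) = mkPos (n , scaled n p , scaled (suc n) q)
    where
    distribute : ∀ c a b p q → c * a * p + c * b * q ≡ c * (a * p + b * q)
    distribute = solve-∀
    scaled : ∀ m → 0ℤ < seq x m → 0ℤ < seq (c ·ᴱ x) m
    scaled m 0<s = subst (0ℤ <_) (sym (distribute c a b (Dℤ m) (Dℤ (suc m)))) (0<i*j 0<c 0<s)

  μ : ℤ → ℕ
  μ (+ zero) = 0
  μ +[1+ k ] = suc (k ℕ.+ k)
  μ -[1+ k ] = suc (suc (k ℕ.+ k))

  -- For φ = (a , M) in [0 , 1), the α-part of α φ is a + δ M = φ - M α⁻¹, which lies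
  -- strictly between -M and 1 when M > 0, and between 0 and 1 - M when M < 0.
  μ-decreasing-pos : ∀ {a k} → NonNeg (a , +[1+ k ]) → (a , +[1+ k ]) <ₛ 1ᴱ → μ (a + δ * +[1+ k ]) ℕ.< μ +[1+ k ]
  μ-decreasing-pos {a} {k} φ≥0 φ<1 = bound (a + δ * M) 0<M′+M 0<1-M′
    where
    M = +[1+ k ]
    0<M′+M : 0ℤ < (a + δ * M) + M
    0<M′+M = Pos-ofℤ⁻ (subst Pos (cong₂ _,_ (e₁ a M δ) (e₂ M)) (NonNeg-+-Pos φ≥0 (Pos-·ᴱ {M} (+<+ (s≤s z≤n)) α⁻¹<1)))
      where
      e₁ : ∀ a M δ → a + M * (1ℤ - - δ) ≡ (a + δ * M) + M
      e₁ = solve-∀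
      e₂ : ∀ M → M + M * (0ℤ - 1ℤ) ≡ 0ℤ
      e₂ = solve-∀
    0<1-M′ : 0ℤ < 1ℤ - (a + δ * M)
    0<1-M′ = Pos-ofℤ⁻ (subst Pos (cong₂ _,_ (e₁ a M δ) (e₂ M)) (Pos-+ φ<1 (Pos-·ᴱ {M} (+<+ (s≤s z≤n)) 0<α⁻¹)))
      where
      e₁ : ∀ a M δ → (1ℤ - a) + M * - δ ≡ 1ℤ - (a + δ * M)
      e₁ = solve-∀
      e₂ : ∀ M → (0ℤ - M) + M * 1ℤ ≡ 0ℤ
      e₂ = solve-∀
    bound : ∀ M′ → 0ℤ < M′ + M → 0ℤ < 1ℤ - M′ → μ M′ ℕ.< suc (k ℕ.+ k)
    bound (+ zero) _ _ = s≤s z≤n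
    bound +[1+ j ] _ 0<-j = ⊥-elim (<⇒≱ 0<-j (subst (_≤ 0ℤ) (sym (cancel (+ j))) (neg-≤-pos {j} {0})))
      where
      cancel : ∀ j → 1ℤ - (1ℤ + j) ≡ - j
      cancel = solve-∀
    bound -[1+ j ] 0<M-j-1 _ = s≤s (subst (ℕ._≤ k ℕ.+ k) (cong suc (ℕₚ.+-suc j j)) (ℕₚ.+-mono-≤ j<k j<k))
      where
      j<k : suc j ℕ.≤ k
      j<k = ℕₚ.≤-pred (drop‿+<+ (0<j-i⇒i<j (subst (0ℤ <_) (swap (+[1+ j ]) M) 0<M-j-1)))
        where
        swap : ∀ j M → - j + M ≡ M - j
        swap = solve-∀
  μ-decreasing-neg : ∀ {a k} → NonNeg (a , -[1+ k ]) → (a , -[1+ k ]) <ₛ 1ᴱ → μ (a + δ * -[1+ k ]) ℕ.< μ -[1+ k ]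
  μ-decreasing-neg {a} {k} φ≥0 φ<1 = bound (a + δ * M) 0<M′ 0<K+1-M′
    where
    M = -[1+ k ]
    K = +[1+ k ]
    0<M′ : 0ℤ < a + δ * M
    0<M′ = Pos-ofℤ⁻ (subst Pos (cong₂ _,_ (e₁ a K δ) (e₂ K)) (NonNeg-+-Pos φ≥0 (Pos-·ᴱ {K} (+<+ (s≤s z≤n)) 0<α⁻¹)))
      where
      e₁ : ∀ a K δ → a + K * - δ ≡ a + δ * - K
      e₁ = solve-∀
      e₂ : ∀ K → - K + K * 1ℤ ≡ 0ℤ
      e₂ = solve-∀
    0<K+1-M′ : 0ℤ < K + 1ℤ - (a + δ * M)
    0<K+1-M′ = Pos-ofℤ⁻ (subst Pos (cong₂ _,_ (e₁ a K δ) (e₂ K)) (Pos-+ φ<1 (Pos-·ᴱ {K} (+<+ (s≤s z≤n)) α⁻¹<1)))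
      where
      e₁ : ∀ a K δ → (1ℤ - a) + K * (1ℤ - - δ) ≡ K + 1ℤ - (a + δ * - K)
      e₁ = solve-∀
      e₂ : ∀ K → (0ℤ - - K) + K * (0ℤ - 1ℤ) ≡ 0ℤ
      e₂ = solve-∀
    bound : ∀ M′ → 0ℤ < M′ → 0ℤ < K + 1ℤ - M′ → μ M′ ℕ.< suc (suc (k ℕ.+ k))
    bound (+ zero) 0<0 _ = ⊥-elim (<-irrefl refl 0<0)
    bound -[1+ j ] 0<M′ _ = ⊥-elim (<-asym 0<M′ -<+)
    bound +[1+ j ] _ 0<K+1-M′ = s≤s (s≤s (ℕₚ.+-mono-≤ j≤k j≤k))
      where
      j≤k : j ℕ.≤ k
      j≤k = ℕₚ.≤-pred (ℕₚ.≤-pred (drop‿+<+ (subst (+[1+ j ] <_) K+1≡ (0<j-i⇒i<j 0<K+1-M′))))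
        where
        K+1≡ : K + 1ℤ ≡ + suc (suc k)
        K+1≡ = trans (sym (pos-+ (suc k) 1)) (cong +_ (ℕₚ.+-comm (suc k) 1))

  μ-decreasing : ∀ {a M} → M ≢ 0ℤ → NonNeg (a , M) → (a , M) <ₛ 1ᴱ → μ (a + δ * M) ℕ.< μ M
  μ-decreasing {M = + zero} M≢0 _ _ = ⊥-elim (M≢0 refl)
  μ-decreasing {M = +[1+ k ]} _ = μ-decreasing-pos
  μ-decreasing {M = -[1+ k ]} _ = μ-decreasing-neg

  ofℤ≤ₛ<ₛofℤ : ∀ {a b y} → ofℤ a ≤ₛ y → y <ₛ ofℤ b → a < b
  ofℤ≤ₛ<ₛofℤ {a} {b} {y = y₁ , y₂} a≤y y<b =
    0<j-i⇒i<j (Pos-ofℤ⁻ (subst Pos (cong₂ _,_ (e₁ a b y₁) (e₂ y₂)) (NonNeg-+-Pos a≤y y<b)))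
    where
    e₁ : ∀ a b y → (y - a) + (b - y) ≡ b - a
    e₁ = solve-∀
    e₂ : ∀ y → (y - 0ℤ) + (0ℤ - y) ≡ 0ℤ
    e₂ = solve-∀

  0≤c<1⇒c≡0 : ∀ {c} → NonNeg (ofℤ c) → ofℤ c <ₛ 1ᴱ → c ≡ 0ℤ
  0≤c<1⇒c≡0 {c} 0≤c c<1 = ≤-antisym (i<j⇒i≤pred[j] (0<j-i⇒i<j {c} {1ℤ} (Pos-ofℤ⁻ c<1))) (NonNeg-ofℤ⁻ 0≤c)

  α^-ofℤ : ∀ k a → α^ suc k · ofℤ a ≡ (a * Dℤ k , a * Dℤ (suc k))
  α^-ofℤ zero a = cong₂ _,_ (e₁ a) (e₂ a δ)
    where
    e₁ : ∀ a → 0ℤ ≡ a * 0ℤ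
    e₁ = solve-∀
    e₂ : ∀ a δ → a + δ * 0ℤ ≡ a * 1ℤ
    e₂ = solve-∀
  α^-ofℤ (suc k) a = trans (cong α·_ (α^-ofℤ k a))
    (cong (a * Dℤ (suc k) ,_) (trans (regroup a (Dℤ (suc k)) (Dℤ k) δ) (cong (a *_) (sym (D-linear k)))))
    where
    regroup : ∀ a p q δ → a * q + δ * (a * p) ≡ a * (δ * p + q)
    regroup = solve-∀

  R-snoc : ∀ w a → R (w ++ a ∷ []) ≡ R w +ᴱ α^ (suc (suc (length w))) · ofℤ (+ a)
  R-snoc w a = trans (cong₂ _,_ (snoc 1) (snoc 2)) (cong (R w +ᴱ_) (sym (α^-ofℤ (suc (length w)) (+ a))))
    where
    snoc : ∀ k → + valFrom k (w ++ a ∷ []) ≡ + valFrom k w + + a * Dℤ (k ℕ.+ length w)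
    snoc k = trans (cong +_ (valFrom-snoc k w a)) (trans (pos-+ (valFrom k w) _) (cong (λ z → + valFrom k w + z) (pos-* a (D (k ℕ.+ length w)))))

  LeadingNonzero : Word → Set
  LeadingNonzero [] = ⊤
  LeadingNonzero (x ∷ _) = 1 ℕ.≤ x

  -- The greedy α-expansion φ = Σ wⱼ α^{j-|w|-1} of a point φ of ℤ[α] ∩ [0 , 1), read
  -- from the last digit; it terminates because the α-part of φ decreases along μ.
  record Expansion (φ : Elt) : Set where
    field
      word : Word
      R-word : R word ≡ α^ (suc (suc (length word))) · φ
      ostTail : OstTail 0 word
      leading : LeadingNonzero word
      top-zero : α· φ <ₛ 1ᴱ → lastOr 0 word ≡ 0
      top-nonzero : 1ᴱ ≤ₛ α· φ → LastNonzero word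
      empty⇒integer : word ≡ [] → proj₂ φ ≡ 0ℤ

  empty-expansion : Expansion 0ᴱ
  empty-expansion = record
    { word = []
    ; R-word = cong₂ _,_ (e₁ δ) (e₂ δ)
    ; ostTail = tt
    ; leading = tt
    ; top-zero = λ _ → refl
    ; top-nonzero = λ 1≤0 → ⊥-elim (<⇒≱ -<+ (NonNeg-ofℤ⁻ (subst NonNeg (cong (-1ℤ ,_) (e₃ δ)) 1≤0)))
    ; empty⇒integer = λ _ → refl
    }
    where
    e₁ : ∀ δ → 0ℤ ≡ 0ℤ + δ * 0ℤ
    e₁ = solve-∀
    e₂ : ∀ δ → 0ℤ ≡ 0ℤ + δ * (0ℤ + δ * 0ℤ)
    e₂ = solve-∀
    e₃ : ∀ δ → (0ℤ + δ * 0ℤ) - 0ℤ ≡ 0ℤ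
    e₃ = solve-∀

  next<1 : ∀ {y} r → y <ₛ ofℤ (+ suc r) → y -ᴱ ofℤ (+ r) <ₛ 1ᴱ
  next<1 {y₁ , y₂} r y<r+1 = subst Pos (cong₂ _,_ (trans (cong (_- y₁) (pos-+ 1 r)) (e₁ (+ r) y₁)) (e₂ y₂)) y<r+1
    where
    e₁ : ∀ r y → (1ℤ + r) - y ≡ 1ℤ - (y - r)
    e₁ = solve-∀
    e₂ : ∀ y → 0ℤ - y ≡ 0ℤ - (y - 0ℤ)
    e₂ = solve-∀

  snoc≢[] : ∀ (v : Word) a → v ++ a ∷ [] ≢ []
  snoc≢[] [] a ()
  snoc≢[] (x ∷ v) a ()

  R-snoc-expansion : ∀ {φ} r {w} → R w ≡ α^ (suc (suc (length w))) · (α· φ -ᴱ ofℤ (+ r)) →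
                     R (w ++ r ∷ []) ≡ α^ (suc (suc (length (w ++ r ∷ [])))) · φ
  R-snoc-expansion {φ@(a , M)} r {w} R≡ = begin
    R (w ++ r ∷ [])                                   ≡⟨ R-snoc w r ⟩
    R w +ᴱ α^ ℓ · ofℤ (+ r)                           ≡⟨ cong (_+ᴱ α^ ℓ · ofℤ (+ r)) R≡ ⟩
    α^ ℓ · φ′ +ᴱ α^ ℓ · ofℤ (+ r)                     ≡⟨ sym (α^-distrib-+ᴱ ℓ φ′ (ofℤ (+ r))) ⟩
    α^ ℓ · (φ′ +ᴱ ofℤ (+ r))                          ≡⟨ cong (α^ ℓ ·_) (cong₂ _,_ (e₁ M (+ r)) (e₂ (a + δ * M))) ⟩
    α^ ℓ · (α· φ)                                     ≡⟨ α^-α· ℓ φ ⟩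
    α^ suc ℓ · φ                                      ≡⟨ cong (λ i → α^ suc (suc i) · φ) (sym length-snoc) ⟩
    α^ (suc (suc (length (w ++ r ∷ [])))) · φ         ∎
    where
    open ≡-Reasoning
    ℓ = suc (suc (length w))
    φ′ = α· φ -ᴱ ofℤ (+ r)
    e₁ : ∀ M r → (M - r) + r ≡ M
    e₁ = solve-∀
    e₂ : ∀ y → (y - 0ℤ) + 0ℤ ≡ y
    e₂ = solve-∀
    length-snoc : length (w ++ r ∷ []) ≡ suc (length w)
    length-snoc = trans (length-++ w) (ℕₚ.+-comm (length w) 1)

  snoc-expansion : ∀ {a M} r → r ℕ.≤ d → M ≢ 0ℤ → (a , M) <ₛ 1ᴱ →
                   ofℤ (+ r) ≤ₛ α· (a , M) → α· (a , M) <ₛ ofℤ (+ suc r) →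
                   Expansion (α· (a , M) -ᴱ ofℤ (+ r)) → Expansion (a , M)
  snoc-expansion {a} {M} r r≤d M≢0 φ<1 r≤y y<r+1 e = record
    { word = w ++ r ∷ []
    ; R-word = R-snoc-expansion {a , M} r {w} R-word
    ; ostTail = OstTail-snoc ostTail r≤d (λ r≡d → top-zero (αφ′<1 r≡d))
    ; leading = leading-snoc w leading empty⇒integer
    ; top-zero = λ y<1 → trans (lastOr-snoc 0 w r) (ℕₚ.n<1⇒n≡0 (drop‿+<+ (ofℤ≤ₛ<ₛofℤ {y = α· (a , M)} r≤y y<1)))
    ; top-nonzero = λ 1≤y → LastNonzero-snoc w (λ r≡0 → ℕₚ.<-irrefl (cong suc (sym r≡0)) (drop‿+<+ (ofℤ≤ₛ<ₛofℤ {y = α· (a , M)} 1≤y y<r+1)))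
    ; empty⇒integer = λ eq → ⊥-elim (snoc≢[] w r eq)
    }
    where
    open Expansion e renaming (word to w)
    φ′ = α· (a , M) -ᴱ ofℤ (+ r)
    αφ′<1 : r ≡ d → α· φ′ <ₛ 1ᴱ
    αφ′<1 refl = subst Pos (cong₂ _,_ (e₁ a M δ) (e₂ a M δ)) (Pos-α (Pos-α φ<1))
      where
      e₁ : ∀ a M δ → (1ℤ - a) + δ * (0ℤ - M) ≡ 1ℤ - ((a + δ * M) - 0ℤ)
      e₁ = solve-∀
      e₂ : ∀ a M δ → (0ℤ - M) + δ * ((1ℤ - a) + δ * (0ℤ - M)) ≡ 0ℤ - ((M - δ) + δ * ((a + δ * M) - 0ℤ))
      e₂ = solve-∀
    leading-snoc : ∀ v → LeadingNonzero v → (v ≡ [] → proj₂ φ′ ≡ 0ℤ) → LeadingNonzero (v ++ r ∷ [])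
    leading-snoc (x ∷ v) 1≤x _ = 1≤x
    leading-snoc [] _ integer = ℕₚ.n≢0⇒n>0 r≢0
      where
      M≡r : M ≡ + r
      M≡r = i-j≡0⇒i≡j M (+ r) (0≤c<1⇒c≡0 (subst NonNeg (cong (M - + r ,_) (integer refl)) r≤y)
                                          (subst (λ z → (M - + r , z) <ₛ 1ᴱ) (integer refl) (next<1 {α· (a , M)} r y<r+1)))
      r≢0 : r ≢ 0
      r≢0 r≡0 = M≢0 (trans M≡r (cong +_ r≡0))

  0≤αφ : ∀ {φ} → NonNeg φ → ofℤ (+ 0) ≤ₛ α· φ
  0≤αφ {a , b} φ≥0 = subst NonNeg (sym (cong₂ _,_ (+-identityʳ b) (+-identityʳ (a + δ * b)))) (NonNeg-α φ≥0)

  αφ<d+1 : ∀ {φ} → φ <ₛ 1ᴱ → α· φ <ₛ ofℤ (+ suc d)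
  αφ<d+1 {a , b} φ<1 = subst Pos (cong₂ _,_ (trans (e₁ b δ) (cong (_- b) (sym (pos-+ 1 d)))) (e₂ a b δ)) (Pos-+ (Pos-α φ<1) α⁻¹<1)
    where
    e₁ : ∀ b δ → (0ℤ - b) + (1ℤ - - δ) ≡ (1ℤ + δ) - b
    e₁ = solve-∀
    e₂ : ∀ a b δ → ((1ℤ - a) + δ * (0ℤ - b)) + (0ℤ - 1ℤ) ≡ 0ℤ - (a + δ * b)
    e₂ = solve-∀

  expansion : ∀ fuel φ → μ (proj₂ φ) ℕ.< fuel → NonNeg φ → φ <ₛ 1ᴱ → Expansion φ
  expansion (suc fuel) (a , M) μ<fuel φ≥0 φ<1 with M ≟ 0ℤ
  ... | yes refl = subst Expansion (cong (_, 0ℤ) (sym (0≤c<1⇒c≡0 φ≥0 φ<1))) empty-expansion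
  ... | no M≢0 = extend (find-digit (α· (a , M)) 0 d refl (0≤αφ φ≥0) (αφ<d+1 {a , M} φ<1))
    where
    μ′<fuel : μ ((a + δ * M) - 0ℤ) ℕ.< fuel
    μ′<fuel = subst (λ m → μ m ℕ.< fuel) (sym (+-identityʳ (a + δ * M))) (ℕₚ.<-≤-trans (μ-decreasing M≢0 φ≥0 φ<1) (ℕₚ.≤-pred μ<fuel))
    extend : Digit (α· (a , M)) → Expansion (a , M)
    extend (r , r≤d , r≤y , y<r+1) = snoc-expansion r r≤d M≢0 φ<1 r≤y y<r+1
      (expansion fuel (α· (a , M) -ᴱ ofℤ (+ r)) μ′<fuel r≤y (next<1 {α· (a , M)} r y<r+1))

  ρ≡⇒negRow₁ : ∀ w {φ} → LastNonzero w → ρ w ≡ φ → negRow w 1 ≡ proj₂ φ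
  ρ≡⇒negRow₁ w lnz ρ≡φ = cong proj₂ (trans (sym (ρ-negRow w (proj₂ (nonempty {w} lnz)))) ρ≡φ)

  coincide⇒ρ≡F : ∀ {k wk} → IsW k wk → Coincide k → Σ Word λ wm → Trimmed wm × ρ wk ≡ F wm
  coincide⇒ρ≡F {wk = wk} iw (wk′ , iw′ , _ , wm , iwm , coincide) with IsW-unique iw iw′
  ... | refl = wm , tm , coincidence⇒ρ≡F {wk} {wm} (Trimmed⇒LastNonzero (proj₁ iw)) (proj₁ tm) (Trimmed⇒LastNonzero tm) coincide
    where tm = proj₁ iwm

  coincide⇒negRow₁-pos : ∀ k wk → IsW k wk → Coincide k → 0ℤ < negRow wk 1
  coincide⇒negRow₁-pos k wk iw co with coincide⇒ρ≡F iw co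
  ... | wm , (_ , lnzm , _) , ρ≡F = subst (0ℤ <_) (sym (ρ≡⇒negRow₁ wk (Trimmed⇒LastNonzero (proj₁ iw)) ρ≡F)) (0<V {wm} lnzm)

  coincide⇒FracCond : ∀ N k wk → IsW k wk → Coincide k → negRow wk 1 ≡ + N → FracCond N
  coincide⇒FracCond N k wk iw co negRow₁≡N with coincide⇒ρ≡F iw co
  ... | wm , (ow , _ , _) , ρ≡F = FracWindow⇒FracCond N (H wm)
    ( subst (λ φ → invα ≤ₛ φ) (trans ρ≡F F≡) (α⁻¹≤ρ {wk} lnzk)
    , subst (λ φ → φ <ₛ (1ᴱ -ᴱ invα)) F≡ (proj₂ (F-window ow)) )
    where
    lnzk = Trimmed⇒LastNonzero (proj₁ iw)
    F≡ : F wm ≡ (- H wm , + N)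
    F≡ = cong (- H wm ,_) (trans (sym (ρ≡⇒negRow₁ wk lnzk ρ≡F)) negRow₁≡N)

  FracWindow⇒unit : ∀ {N q} → FracWindow N q → NonNeg (- q , + N) × (- q , + N) <ₛ 1ᴱ
  FracWindow⇒unit {N} {q} (lower , upper) =
    Pos⇒NonNeg (subst Pos (cong₂ _,_ (e₁ (- q) δ) (e₂ (+ N))) (NonNeg-+-Pos lower 0<α⁻¹)) ,
    subst Pos (cong₂ _,_ (e₃ (- q) δ) (e₄ (+ N))) (Pos-+ upper 0<α⁻¹)
    where
    e₁ : ∀ a δ → (a - - δ) + - δ ≡ a
    e₁ = solve-∀
    e₂ : ∀ n → (n - 1ℤ) + 1ℤ ≡ n
    e₂ = solve-∀
    e₃ : ∀ a δ → ((1ℤ - - δ) - a) + - δ ≡ 1ℤ - a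
    e₃ = solve-∀
    e₄ : ∀ n → ((0ℤ - 1ℤ) - n) + 1ℤ ≡ 0ℤ - n
    e₄ = solve-∀

  -- Prepending 0 when the expansion starts with the digit d makes it trimmed.
  trimmed-word : ∀ {φ} (e : Expansion φ) → LastNonzero (Expansion.word e) →
                 Σ Word λ wk → Trimmed wk × R wk ≡ α^ (suc (suc (length wk))) · φ
  trimmed-word {φ} e lnz with Expansion.word e | Expansion.R-word e | Expansion.ostTail e | Expansion.leading e
  ... | x ∷ t | R≡ | (x≤d , _ , t-tail) | 1≤x with x ℕ.<? d
  ...   | yes x<d = x ∷ t , ((x<d , t-tail) , lnz , λ { (_ , _ , eq) → ℕₚ.<⇒≢ 1≤x (sym (∷-injectiveˡ eq)) }) , R≡
  ...   | no x≮d = 0 ∷ x ∷ t , ((0<d , (x≤d , (λ _ → refl) , t-tail)) , lnz , λ { (_ , ov , eq) → x≮d (proj₁ (subst OstWord (sym (∷-injectiveʳ eq)) ov)) }) , R0∷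
    where
    R0∷ : R (0 ∷ x ∷ t) ≡ α^ (suc (suc (length (0 ∷ x ∷ t)))) · φ
    R0∷ = trans (R-cons 0 (x ∷ t)) (cong α·_ (trans (cong₂ _,_ (+-identityˡ (V (x ∷ t))) (e₁ (H (x ∷ t)) δ)) R≡))
      where
      e₁ : ∀ h δ → (0ℤ + δ * 0ℤ) + h ≡ h
      e₁ = solve-∀

  window⇒negative-word : ∀ {N q} → FracWindow N q → Σ Word λ wk → Trimmed wk × ρ wk ≡ (- q , + N)
  window⇒negative-word {N} {q} window = wk , twk , α^-injective (suc (suc (length wk))) (trans (α^-ρ wk) R≡)
    where
    φ≥0 = proj₁ (FracWindow⇒unit {N} {q} window)
    φ<1 = proj₂ (FracWindow⇒unit {N} {q} window)
    e : Expansion (- q , + N)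
    e = expansion (suc (μ (+ N))) (- q , + N) (ℕₚ.n<1+n _) φ≥0 φ<1
    trimmed : Σ Word λ wk → Trimmed wk × R wk ≡ α^ (suc (suc (length wk))) · (- q , + N)
    trimmed = trimmed-word e (Expansion.top-nonzero e (α⁻¹≤φ⇒1≤αφ { - q , + N} (proj₁ window)))
    wk = proj₁ trimmed
    twk = proj₁ (proj₂ trimmed)
    R≡ = proj₂ (proj₂ trimmed)

  window⇒ostrowski-word : ∀ {N q} → 0 ℕ.< N → FracWindow N q → Σ Word λ v → Trimmed v × F v ≡ (- q , + N)
  window⇒ostrowski-word {N} {q} 0<N window@(α⁻¹≤φ , φ<1-α⁻¹) = v , (ov , lnzv , α⁻¹≤F⇒¬0∷ (subst (invα ≤ₛ_) (sym F≡φ) α⁻¹≤φ)) , F≡φ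
    where
    representation-N = ostrowski-representation N 0<N
    v = proj₁ representation-N
    ov = proj₁ (proj₂ representation-N)
    lnzv = proj₁ (proj₂ (proj₂ representation-N))
    V≡N : V v ≡ + N
    V≡N = cong +_ (proj₂ (proj₂ (proj₂ representation-N)))
    -α⁻¹<Fv : negᴱ invα <ₛ (- H v , + N)
    -α⁻¹<Fv = subst (λ z → negᴱ invα <ₛ (- H v , z)) V≡N (proj₁ (F-window ov))
    Fv<1-α⁻¹ : (- H v , + N) <ₛ (1ᴱ -ᴱ invα)
    Fv<1-α⁻¹ = subst (λ z → (- H v , z) <ₛ (1ᴱ -ᴱ invα)) V≡N (proj₂ (F-window ov))
    -α⁻¹<φ : negᴱ invα <ₛ (- q , + N)
    -α⁻¹<φ = subst Pos (cong₂ _,_ (e₁ (- q) δ) (e₂ (+ N))) (NonNeg-+-Pos (proj₁ (FracWindow⇒unit {N} {q} window)) 0<α⁻¹)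
      where
      e₁ : ∀ a δ → a + - δ ≡ a - - - δ
      e₁ = solve-∀
      e₂ : ∀ n → n + 1ℤ ≡ n - - 1ℤ
      e₂ = solve-∀
    F≡φ : F v ≡ (- q , + N)
    F≡φ = cong₂ _,_ (cong -_ (≤-antisym (window-≤ {v = + N} -α⁻¹<Fv φ<1-α⁻¹) (window-≤ {v = + N} -α⁻¹<φ Fv<1-α⁻¹))) V≡N

  FracCond⇒coincide : ∀ N → 0 ℕ.< N → FracCond N →
                      Σ ℕ λ k → Σ Word λ wk → IsW k wk × (Coincide k × (negRow wk 1 ≡ + N))
  FracCond⇒coincide N 0<N fc =
    k , wk , iwk , (wk , iwk , m , v , iwv , coincidence) , ρ≡⇒negRow₁ wk (Trimmed⇒LastNonzero twk) ρ≡φ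
    where
    q = proj₁ (FracCond⇒FracWindow N fc)
    window = proj₂ (FracCond⇒FracWindow N fc)
    negative-word = window⇒negative-word {N} {q} window
    ostrowski-word = window⇒ostrowski-word {N} {q} 0<N window
    wk = proj₁ negative-word
    twk = proj₁ (proj₂ negative-word)
    ρ≡φ = proj₂ (proj₂ negative-word)
    v = proj₁ ostrowski-word
    tv = proj₁ (proj₂ ostrowski-word)
    F≡φ = proj₂ (proj₂ ostrowski-word)
    coincidence : Coincidence wk v
    coincidence = ρ≡F⇒coincidence {wk} {v} (proj₂ (nonempty {wk} (Trimmed⇒LastNonzero twk))) (trans ρ≡φ (sym F≡φ))
    k = proj₁ (IsW-exists twk)
    iwk = proj₂ (IsW-exists twk)
    m = proj₁ (IsW-exists tv)
    iwv = proj₂ (IsW-exists tv)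

corollary7 : (d : ℕ) → 2 ℕ.≤ d → let open Ost d in
    (((k : ℕ) (wk : Word) → IsW k wk → Coincide k → + 0 ℤ.< negRow wk 1)
    × ((N : ℕ) → 0 ℕ.< N →
    ((Σ ℕ λ k → Σ Word λ wk → IsW k wk × (Coincide k × (negRow wk 1 ≡ + N))) ⇔ FracCond N)))
corollary7 d 2≤d = coincide⇒negRow₁-pos , λ N 0<N → mk⇔
  (λ (k , wk , iw , co , negRow₁≡N) → coincide⇒FracCond N k wk iw co negRow₁≡N)
  (FracCond⇒coincide N 0<N)
  where open Ostrowski d 2≤d
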